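{- Let $a,b$ be positive integers and let $\lambda=(\lambda_1,\lambda_2,\dots)$ be any partition of $b$ (with $\lambda_i=0$ for $i>l(\lambda)$), with conjugate $\lambda'=(\lambda'_1,\lambda'_2,\dots)$. Put $Y_0=0$ and $Y_i=\sum_{j=1}^i\lambda_j$ for $i\ge1$, and $$F_\lambda(q)=q^{2\sum_{i\geq 1}\binom{\lambda_i}{2}} \prod_{j\geq 1} \binom{j(a+2)-Y_{j-1}-Y_{j+1}}{\lambda_j-\lambda_{j+1}}_q .$$ Then $F_\lambda(q)$ is the generating function (by size) for all $\lambda_1$-modular diagrams $\Lambda$ of length $b$, contained inside an $a\times b$ rectangle, satisfying the following conditions: (1) $\Lambda$ has exactly $\lambda'_i$ rows labeled $i$, for each $i\ge1$; (2) if $\Sigma_i$ denotes the sum of the lengths of all rows of $\Lambda$ labeled $i$, then for every positive integer $j$, $$\Sigma_{\lambda_{j+1}+1}\leq \Sigma_{\lambda_{j+1}+2}\leq \dots \leq \Sigma_{\lambda_j}\leq j(a+1+\lambda_j+\lambda_{j+1}) -2Y_j$$ (this condition being empty when $\lambda_j=\lambda_{j+1}$); (3) for every positive integer $j$, every row labeled with an integer between $\lambda_{j+1}+1$ and $\lambda_j$ has length at least $\lambda_j+\lambda_{j+1}-1$; (4) for each label, the lengths of the longest and the shortest row carrying that label differ by at most $1$.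
   Context: $\binom{n}{k}_q$ denotes the Gaussian polynomial ($q$-binomial coefficient) $\frac{(1-q)\cdots(1-q^n)}{(1-q)\cdots(1-q^k)(1-q)\cdots(1-q^{n-k})}$. A partition is a weakly decreasing sequence of nonnegative integers with finitely many nonzero terms (its parts); $l(\lambda)$ is the number of parts, and $\lambda'$ is the conjugate partition. Modular diagrams (nonstandard definition): Fix a partition $\mu$ and positive integers $k\ge l(\mu)$ and $N$. An $N$-modular diagram of length $k$ consists of $k$ rows, the $i$-th row having length $\mu_i\ge 0$ (so rows of length zero are allowed), drawn as the Ferrers diagram of $\mu$ to which a zeroth column of $k$ cells has been added on the left (so row $i$ has $\mu_i+1$ cells, its zeroth cell plus $\mu_i$ further cells). Every cell is labeled with an integer between $1$ and $N$, every cell of a row other than its rightmost cell is labeled $N$, and the labels in each column are weakly decreasing from top to bottom. A row is said to be labeled $i$ if its rightmost cell (which is the zeroth cell when the row has length zero) is labeled $i$. The length of a row is $\mu_i$ (the zeroth cell is not counted), and the size of the diagram is $|\mu|=\sum_i\mu_i$; generating functions count diagrams by $q^{\text{size}}$. The diagram is contained inside an $a\times b$ rectangle if it has length $k=b$ and all row lengths are at most $a$. -}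

module Defs where

open import Data.Nat using (ℕ; zero; suc; _+_; _*_; _∸_; _≤_; _<_; _≟_)
open import Data.Nat.Combinatorics using (_C_)
open import Data.Nat.ListAction using (sum)
open import Data.List using (List; []; _∷_; length; map; filter; take; replicate; _++_; applyUpTo)
open import Data.List.Relation.Unary.All using (All)
open import Data.List.Relation.Unary.Unique.Propositional using (Unique)
open import Data.List.Relation.Unary.Linked using (Linked)
open import Data.List.Membership.Propositional using (_∈_)
open import Data.Product using (Σ; _×_)
open import Relation.Binary.PropositionalEquality using (_≡_)

-- Polynomials in q with natural-number coefficients, as coefficient
-- lists (constant term first).

Poly : Set
Poly = List ℕ

infixl 6 _⊕_
infixl 7 _⊛_

_⊕_ : Poly → Poly → Poly
[]       ⊕ q        = q
(x ∷ p)  ⊕ []       = x ∷ p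
(x ∷ p)  ⊕ (y ∷ q)  = (x + y) ∷ (p ⊕ q)

_⊛_ : Poly → Poly → Poly
[]      ⊛ q = []
(x ∷ p) ⊛ q = map (x *_) q ⊕ (0 ∷ (p ⊛ q))

shift : ℕ → Poly → Poly
shift k p = replicate k 0 ++ p

one : Poly
one = 1 ∷ []

coeff : Poly → ℕ → ℕ
coeff []       n       = 0
coeff (x ∷ p)  zero    = x
coeff (x ∷ p)  (suc n) = coeff p n

prodP : List Poly → Poly
prodP []       = one
prodP (p ∷ ps) = p ⊛ prodP ps

-- Gaussian polynomial [n choose k]_q, via the q-Pascal recurrence
-- [n+1 choose k+1] = [n choose k] + q^(k+1) [n choose k+1];
-- [n choose 0] = 1, [0 choose k+1] = 0.
gauss : ℕ → ℕ → Poly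
gauss zero    zero    = one
gauss zero    (suc k) = []
gauss (suc n) zero    = one
gauss (suc n) (suc k) = gauss n k ⊕ shift (suc k) (gauss n (suc k))

IsPartitionOf : ℕ → List ℕ → Set
IsPartitionOf b lam = Linked (λ x y → y ≤ x) lam × All (1 ≤_) lam × sum lam ≡ b

-- i-th part, 1-indexed (part lam 0 is unused); 0 beyond the length.
part : List ℕ → ℕ → ℕ
part []        _             = 0
part (x ∷ xs)  zero          = 0
part (x ∷ xs)  (suc zero)    = x
part (x ∷ xs)  (suc (suc i)) = part xs (suc i)

conj : List ℕ → ℕ → ℕ
conj lam i = length (filter (λ x → Data.Nat._≤?_ i x) lam)

Y : List ℕ → ℕ → ℕ
Y lam i = sum (take i lam)

-- F_lambda(q), with the product over j ≥ 1 taken over j = 1..b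
-- (all further factors are [n choose 0]_q = 1).
F : ℕ → ℕ → List ℕ → Poly
F a b lam =
  shift (2 * sum (map (λ x → x C 2) lam))
    (prodP (applyUpTo (λ i → let j = suc i in
       gauss (j * (a + 2) ∸ Y lam (j ∸ 1) ∸ Y lam (suc j))
             (part lam j ∸ part lam (suc j))) b))

-- Modular diagrams.  A diagram is a list of rows (row 0 on top); each
-- row is the list of labels of its cells, zeroth cell first.  Thus a
-- row with list of labels r has length  length r ∸ 1.

Diagram : Set
Diagram = List (List ℕ)

rowAt : Diagram → ℕ → List ℕ
rowAt []       _       = []
rowAt (r ∷ rs) zero    = r
rowAt (r ∷ rs) (suc i) = rowAt rs i

at : List ℕ → ℕ → ℕ
at []       _       = 0
at (x ∷ xs) zero    = x
at (x ∷ xs) (suc c) = at xs c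

cell : Diagram → ℕ → ℕ → ℕ
cell D i c = at (rowAt D i) c

len : List ℕ → ℕ
len r = length r ∸ 1

lastOr : ℕ → List ℕ → ℕ
lastOr d []       = d
lastOr d (x ∷ xs) = lastOr x xs

label : List ℕ → ℕ
label r = lastOr 0 r

size : Diagram → ℕ
size D = sum (map len D)

IsModular : ℕ → ℕ → Diagram → Set
IsModular N k D =
    length D ≡ k
  × All (λ r → 1 ≤ length r) D
  × (∀ i → len (rowAt D (suc i)) ≤ len (rowAt D i))
  × All (All (λ x → 1 ≤ x × x ≤ N)) D
  × (∀ i c → suc c < length (rowAt D i) → cell D i c ≡ N)
  × (∀ i j c → i < j → c < length (rowAt D j) → cell D j c ≤ cell D i c)

InRect : ℕ → ℕ → Diagram → Set
InRect a b D = length D ≡ b × All (λ r → len r ≤ a) D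

rowsLabeled : ℕ → Diagram → List (List ℕ)
rowsLabeled i D = filter (λ r → label r ≟ i) D

Sig : Diagram → ℕ → ℕ
Sig D i = sum (map len (rowsLabeled i D))

Cond1 : List ℕ → Diagram → Set
Cond1 lam D = ∀ i → 1 ≤ i → length (rowsLabeled i D) ≡ conj lam i

Cond2 : ℕ → List ℕ → Diagram → Set
Cond2 a lam D = ∀ j → 1 ≤ j →
    (∀ i → suc (part lam (suc j)) ≤ i → i < part lam j → Sig D i ≤ Sig D (suc i))
  × (part lam (suc j) < part lam j →
       Sig D (part lam j) + 2 * Y lam j
         ≤ j * (a + 1 + part lam j + part lam (suc j)))

Cond3 : List ℕ → Diagram → Set
Cond3 lam D = ∀ j → 1 ≤ j → All (λ r →
    suc (part lam (suc j)) ≤ label r → label r ≤ part lam j →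
    part lam j + part lam (suc j) ∸ 1 ≤ len r) D

Cond4 : Diagram → Set
Cond4 D = ∀ i → All (λ r → All (λ s → len r ≤ suc (len s)) (rowsLabeled i D)) (rowsLabeled i D)

Valid : ℕ → ℕ → List ℕ → Diagram → Set
Valid a b lam D =
  IsModular (part lam 1) b D × InRect a b D
  × Cond1 lam D × Cond2 a lam D × Cond3 lam D × Cond4 D

HasCount : {A : Set} → (A → Set) → ℕ → Set
HasCount {A} P c = Σ (List A) λ xs →
  Unique xs × (∀ x → x ∈ xs → P x) × (∀ x → P x → x ∈ xs) × length xs ≡ c

module Submission where

-- A valid diagram is determined by its row sums Σ_1, …, Σ_{λ_1}.  By (1) and (4) the λ′_i rows
-- labelled i have lengths differing by at most one, so they are the balanced split of Σ_i into
-- λ′_i parts, and the order of the rows is forced by the modular conditions.  Group the labels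
-- into blocks λ_{j+1} < i ≤ λ_j, on which λ′_i = j.  Conditions (2) and (3) then say exactly that
-- on each block the Σ_i increase weakly and lie in the window
--   [j (λ_j + λ_{j+1} − 1), j (a + 1 + λ_j + λ_{j+1}) − 2Y_j],
-- and these bounds already keep every row inside the a × b rectangle.  Weakly increasing
-- sequences of length λ_j − λ_{j+1} in such a window are counted by the j-th Gaussian factor
-- of F_λ, shifted by (λ_j − λ_{j+1}) j (λ_j + λ_{j+1} − 1); summation by parts turns the total
-- shift into 2 Σ_i binom(λ_i, 2).

open import Defs
open import Data.Bool using (if_then_else_)
open import Data.List using (List; []; _∷_; map; concat; _++_; replicate; length; filter; take; drop;
  concatMap; applyUpTo; cartesianProductWith)
open import Data.List.Properties using (map-++; length-map; length-replicate; length-++; map-∘;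
  map-id; map-cong-local; map-injective; ∷-injectiveʳ; ++-cancelʳ; take++drop≡id; length-take;
  length-drop; take-all; filter-++; filter-all; filter-none; filter-accept; filter-reject; ++-identityʳ)
open import Data.List.Membership.Propositional using (_∈_; _∉_; find)
open import Data.List.Membership.Propositional.Properties
open import Data.List.Relation.Binary.Permutation.Propositional
  using (_↭_; ↭-refl; ↭-sym; ↭-trans; prep; ↭-reflexive; ↭⇒↭ₛ)
import Data.List.Relation.Binary.Permutation.Propositional.Properties as Perm
open import Data.List.Relation.Binary.Pointwise using (Pointwise-≡⇒≡)
open import Data.List.Relation.Unary.All as All using (All; []; _∷_)
import Data.List.Relation.Unary.All.Properties as All
open import Data.List.Relation.Unary.AllPairs using (AllPairs; []; _∷_)
open import Data.List.Relation.Unary.Any using (here; there)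
open import Data.List.Relation.Unary.Linked as Linked using (Linked; []; [-]; _∷_)
import Data.List.Relation.Unary.Linked.Properties as Linked
open import Data.List.Relation.Unary.Sorted.TotalOrder.Properties using (↗↭↗⇒≋)
open import Data.List.Relation.Unary.Unique.Propositional using (Unique)
import Data.List.Relation.Unary.Unique.Propositional.Properties as Unique
open import Data.Nat
open import Data.Nat.Combinatorics using (_C_; nC1≡n; nCk+nC[k+1]≡[n+1]C[k+1])
open import Data.Nat.DivMod
open import Data.Nat.ListAction using (sum)
open import Data.Nat.ListAction.Properties using (sum-++; sum-↭)
open import Data.Nat.Properties
open import Data.Nat.Solver using (module +-*-Solver)
open import Data.Product using (Σ; _×_; _,_; proj₁; proj₂)
open import Data.Product.Properties using (≡-dec)
open import Data.Sum using (_⊎_; inj₁; inj₂)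
open import Function using (_∘_; case_of_; _⇔_; mk⇔; Equivalence)
open import Relation.Binary.Bundles using (DecTotalOrder)
open import Relation.Binary.Definitions using (tri<; tri>; tri≈)
open import Relation.Binary.PropositionalEquality
open import Relation.Nullary using (¬_; ¬?; Dec; yes; no; contradiction)
open import Algebra.Properties.CommutativeSemigroup +-commutativeSemigroup using (interchange)
open +-*-Solver

monomial : ℕ → ℕ → ℕ
monomial x n = if x ≡ᵇ n then 1 else 0

shifted : ℕ → (ℕ → ℕ) → ℕ → ℕ
shifted zero    g n       = g n
shifted (suc d) g zero    = 0
shifted (suc d) g (suc n) = shifted d g n

convolve : (ℕ → ℕ) → (ℕ → ℕ) → ℕ → ℕ
convolve f g zero    = f 0 * g 0
convolve f g (suc n) = f 0 * g (suc n) + convolve (λ i → f (suc i)) g n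

-- The coefficients of the generating polynomial Σ_{x ∈ xs} q ^ x.
occurrences : List ℕ → ℕ → ℕ
occurrences []       n = 0
occurrences (x ∷ xs) n = monomial x n + occurrences xs n

occurrences-++ : ∀ xs ys n → occurrences (xs ++ ys) n ≡ occurrences xs n + occurrences ys n
occurrences-++ []       ys n = refl
occurrences-++ (x ∷ xs) ys n = trans (cong (monomial x n +_) (occurrences-++ xs ys n))
                                     (sym (+-assoc (monomial x n) _ _))

shifted-+ : ∀ d f g n → shifted d (λ m → f m + g m) n ≡ shifted d f n + shifted d g n
shifted-+ zero    f g n       = refl
shifted-+ (suc d) f g zero    = refl
shifted-+ (suc d) f g (suc n) = shifted-+ d f g n

shifted-zero : ∀ d f → (∀ m → f m ≡ 0) → ∀ n → shifted d f n ≡ 0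
shifted-zero zero    f f≡0 n       = f≡0 n
shifted-zero (suc d) f f≡0 zero    = refl
shifted-zero (suc d) f f≡0 (suc n) = shifted-zero d f f≡0 n

shifted-cong : ∀ d {f g} → (∀ m → f m ≡ g m) → ∀ n → shifted d f n ≡ shifted d g n
shifted-cong zero    f≗g n       = f≗g n
shifted-cong (suc d) f≗g zero    = refl
shifted-cong (suc d) f≗g (suc n) = shifted-cong d f≗g n

shifted-shifted : ∀ d e f n → shifted d (shifted e f) n ≡ shifted (d + e) f n
shifted-shifted zero    e f n       = refl
shifted-shifted (suc d) e f zero    = refl
shifted-shifted (suc d) e f (suc n) = shifted-shifted d e f n

monomial-+ : ∀ d x n → monomial (d + x) n ≡ shifted d (monomial x) n
monomial-+ zero    x n       = refl
monomial-+ (suc d) x zero    = refl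
monomial-+ (suc d) x (suc n) = monomial-+ d x n

occurrences-map-+ : ∀ d xs n → occurrences (map (d +_) xs) n ≡ shifted d (occurrences xs) n
occurrences-map-+ d []       n = sym (shifted-zero d _ (λ _ → refl) n)
occurrences-map-+ d (x ∷ xs) n = begin
  monomial (d + x) n + occurrences (map (d +_) xs) n
    ≡⟨ cong₂ _+_ (monomial-+ d x n) (occurrences-map-+ d xs n) ⟩
  shifted d (monomial x) n + shifted d (occurrences xs) n
    ≡⟨ shifted-+ d (monomial x) (occurrences xs) n ⟨
  shifted d (occurrences (x ∷ xs)) n ∎
  where open ≡-Reasoning

convolve-congˡ : ∀ {f f'} g → (∀ m → f m ≡ f' m) → ∀ n → convolve f g n ≡ convolve f' g n
convolve-congˡ g f≗f' zero    = cong (_* g 0) (f≗f' 0)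
convolve-congˡ g f≗f' (suc n) =
  cong₂ _+_ (cong (_* g (suc n)) (f≗f' 0)) (convolve-congˡ g (λ m → f≗f' (suc m)) n)

convolve-congʳ : ∀ f {g g'} → (∀ m → g m ≡ g' m) → ∀ n → convolve f g n ≡ convolve f g' n
convolve-congʳ f g≗g' zero    = cong (f 0 *_) (g≗g' 0)
convolve-congʳ f g≗g' (suc n) =
  cong₂ _+_ (cong (f 0 *_) (g≗g' (suc n))) (convolve-congʳ _ g≗g' n)

convolve-zeroˡ : ∀ f g → (∀ m → f m ≡ 0) → ∀ n → convolve f g n ≡ 0
convolve-zeroˡ f g f≡0 zero    rewrite f≡0 0 = refl
convolve-zeroˡ f g f≡0 (suc n) rewrite f≡0 0 = convolve-zeroˡ _ g (λ m → f≡0 (suc m)) n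

convolve-distribʳ-+ : ∀ f f' g n →
  convolve (λ m → f m + f' m) g n ≡ convolve f g n + convolve f' g n
convolve-distribʳ-+ f f' g zero    = *-distribʳ-+ (g 0) (f 0) (f' 0)
convolve-distribʳ-+ f f' g (suc n) = begin
  (f 0 + f' 0) * g (suc n) + convolve (λ i → f (suc i) + f' (suc i)) g n
    ≡⟨ cong₂ _+_ (*-distribʳ-+ (g (suc n)) (f 0) (f' 0))
                 (convolve-distribʳ-+ (λ i → f (suc i)) (λ i → f' (suc i)) g n) ⟩
  (f 0 * g (suc n) + f' 0 * g (suc n)) + (convolve _ g n + convolve _ g n)
    ≡⟨ interchange (f 0 * g (suc n)) _ _ _ ⟩
  convolve f g (suc n) + convolve f' g (suc n) ∎
  where open ≡-Reasoning

convolve-monomialˡ : ∀ d g n → convolve (monomial d) g n ≡ shifted d g n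
convolve-monomialˡ zero    g zero    = +-identityʳ (g 0)
convolve-monomialˡ (suc d) g zero    = refl
convolve-monomialˡ zero    g (suc n) =
  trans (cong₂ _+_ (+-identityʳ (g (suc n))) (convolve-zeroˡ _ g (λ _ → refl) n)) (+-identityʳ _)
convolve-monomialˡ (suc d) g (suc n) = convolve-monomialˡ d g n

convolve-shiftedˡ : ∀ d f g n → convolve (shifted d f) g n ≡ shifted d (convolve f g) n
convolve-shiftedˡ zero    f g n       = refl
convolve-shiftedˡ (suc d) f g zero    = refl
convolve-shiftedˡ (suc d) f g (suc n) = convolve-shiftedˡ d f g n

convolve-shiftedʳ : ∀ d f g n → convolve f (shifted d g) n ≡ shifted d (convolve f g) n
convolve-shiftedʳ zero    f g n       = refl
convolve-shiftedʳ (suc d) f g zero    = *-zeroʳ (f 0)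
convolve-shiftedʳ (suc d) f g (suc n) = trans (shift-one f n) (convolve-shiftedʳ d f g n)
  where
  shift-one : ∀ f n → convolve f (shifted (suc d) g) (suc n) ≡ convolve f (shifted d g) n
  shift-one f zero    = trans (cong (f 0 * shifted d g 0 +_) (*-zeroʳ (f 1))) (+-identityʳ _)
  shift-one f (suc n) = cong (f 0 * shifted d g (suc n) +_) (shift-one (λ i → f (suc i)) n)

coeff-⊕ : ∀ p q n → coeff (p ⊕ q) n ≡ coeff p n + coeff q n
coeff-⊕ []      q       n       = refl
coeff-⊕ (x ∷ p) []      zero    = sym (+-identityʳ x)
coeff-⊕ (x ∷ p) []      (suc n) = sym (+-identityʳ _)
coeff-⊕ (x ∷ p) (y ∷ q) zero    = refl
coeff-⊕ (x ∷ p) (y ∷ q) (suc n) = coeff-⊕ p q n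

coeff-map-* : ∀ x q n → coeff (map (x *_) q) n ≡ x * coeff q n
coeff-map-* x []      n       = sym (*-zeroʳ x)
coeff-map-* x (y ∷ q) zero    = refl
coeff-map-* x (y ∷ q) (suc n) = coeff-map-* x q n

coeff-⊛ : ∀ p q n → coeff (p ⊛ q) n ≡ convolve (coeff p) (coeff q) n
coeff-⊛ []      q n       = sym (convolve-zeroˡ _ _ (λ _ → refl) n)
coeff-⊛ (x ∷ p) q zero    = begin
  coeff (map (x *_) q ⊕ (0 ∷ p ⊛ q)) 0 ≡⟨ coeff-⊕ (map (x *_) q) _ 0 ⟩
  coeff (map (x *_) q) 0 + 0           ≡⟨ +-identityʳ _ ⟩
  coeff (map (x *_) q) 0               ≡⟨ coeff-map-* x q 0 ⟩
  x * coeff q 0                        ∎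
  where open ≡-Reasoning
coeff-⊛ (x ∷ p) q (suc n) = begin
  coeff (map (x *_) q ⊕ (0 ∷ p ⊛ q)) (suc n)      ≡⟨ coeff-⊕ (map (x *_) q) _ (suc n) ⟩
  coeff (map (x *_) q) (suc n) + coeff (p ⊛ q) n  ≡⟨ cong₂ _+_ (coeff-map-* x q (suc n)) (coeff-⊛ p q n) ⟩
  x * coeff q (suc n) + convolve (coeff p) (coeff q) n ∎
  where open ≡-Reasoning

coeff-shift : ∀ d p n → coeff (shift d p) n ≡ shifted d (coeff p) n
coeff-shift zero    p n       = refl
coeff-shift (suc d) p zero    = refl
coeff-shift (suc d) p (suc n) = coeff-shift d p n

coeff-one : ∀ n → coeff one n ≡ monomial 0 n
coeff-one zero    = refl
coeff-one (suc n) = refl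

coeff-gauss-0 : ∀ n m → coeff (gauss n 0) m ≡ monomial 0 m
coeff-gauss-0 zero    m = coeff-one m
coeff-gauss-0 (suc n) m = coeff-one m

coeff-gauss-pascal : ∀ n k m →
  coeff (gauss (suc n) (suc k)) m ≡ coeff (gauss n k) m + shifted (suc k) (coeff (gauss n (suc k))) m
coeff-gauss-pascal n k m =
  trans (coeff-⊕ (gauss n k) _ m) (cong (coeff (gauss n k) m +_) (coeff-shift (suc k) (gauss n (suc k)) m))

coeff-gauss-> : ∀ n k → n < k → ∀ m → coeff (gauss n k) m ≡ 0
coeff-gauss-> zero    (suc k) _         m = refl
coeff-gauss-> (suc n) (suc k) (s≤s n<k) m = begin
  coeff (gauss (suc n) (suc k)) m
    ≡⟨ coeff-gauss-pascal n k m ⟩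
  coeff (gauss n k) m + shifted (suc k) (coeff (gauss n (suc k))) m
    ≡⟨ cong₂ _+_ (coeff-gauss-> n k n<k m)
                 (shifted-zero (suc k) _ (coeff-gauss-> n (suc k) (m<n⇒m<1+n n<k)) m) ⟩
  0 ∎
  where open ≡-Reasoning

coeff-gauss-diag : ∀ k m → coeff (gauss k k) m ≡ monomial 0 m
coeff-gauss-diag zero    m = coeff-one m
coeff-gauss-diag (suc k) m = begin
  coeff (gauss (suc k) (suc k)) m
    ≡⟨ coeff-gauss-pascal k k m ⟩
  coeff (gauss k k) m + shifted (suc k) (coeff (gauss k (suc k))) m
    ≡⟨ cong₂ _+_ (coeff-gauss-diag k m) (shifted-zero (suc k) _ (coeff-gauss-> k (suc k) (n<1+n k)) m) ⟩
  monomial 0 m + 0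
    ≡⟨ +-identityʳ _ ⟩
  monomial 0 m ∎
  where open ≡-Reasoning

-- Gaussian polynomials count bounded weakly increasing sequences

sum-map-add : ∀ L s → sum (map (L +_) s) ≡ length s * L + sum s
sum-map-add L []      = refl
sum-map-add L (x ∷ s) rewrite sum-map-add L s =
  solve 4 (λ L x n t → L :+ x :+ (n :* L :+ t) := L :+ n :* L :+ (x :+ t)) refl L x (length s) (sum s)

occurrences-sum-map-add : ∀ L k xss → All (λ s → length s ≡ k) xss → ∀ n →
  occurrences (map sum (map (map (L +_)) xss)) n ≡ shifted (k * L) (occurrences (map sum xss)) n
occurrences-sum-map-add L k xss lengths n =
  trans (cong (λ ys → occurrences ys n) sums) (occurrences-map-+ (k * L) (map sum xss) n)
  where
  sums : map sum (map (map (L +_)) xss) ≡ map (k * L +_) (map sum xss)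
  sums = trans (sym (map-∘ xss))
    (trans (map-cong-local (All.map (λ {s} ∣s∣≡k → trans (sum-map-add L s) (cong (λ l → l * L + sum s) ∣s∣≡k))
                                    lengths))
           (map-∘ xss))

sum-replicate : ∀ n x → sum (replicate n x) ≡ n * x
sum-replicate zero    x = refl
sum-replicate (suc n) x = cong (x +_) (sum-replicate n x)

Ascending : ℕ → ℕ → List ℕ → Set
Ascending k w s = length s ≡ k × Linked _≤_ s × All (_≤ w) s

-- According to whether the first entry is 0: the q-Pascal recurrence.
ascending : ℕ → ℕ → List (List ℕ)
ascending zero    w       = [] ∷ []
ascending (suc k) zero    = replicate (suc k) 0 ∷ []
ascending (suc k) (suc w) = map (0 ∷_) (ascending k (suc w)) ++ map (map suc) (ascending (suc k) w)

linked-replicate : ∀ {R : ℕ → ℕ → Set} {x} → R x x → ∀ k → Linked R (replicate k x)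
linked-replicate Rxx zero          = []
linked-replicate Rxx (suc zero)    = [-]
linked-replicate Rxx (suc (suc k)) = Rxx ∷ linked-replicate Rxx (suc k)

all-≤0⇒replicate : ∀ s → All (_≤ 0) s → s ≡ replicate (length s) 0
all-≤0⇒replicate []      []          = refl
all-≤0⇒replicate (0 ∷ s) (z≤n ∷ s≤0) = cong (0 ∷_) (all-≤0⇒replicate s s≤0)

linked-0∷ : ∀ {s} → Linked _≤_ s → Linked _≤_ (0 ∷ s)
linked-0∷ {[]}    _   = [-]
linked-0∷ {x ∷ s} asc = z≤n ∷ asc

ascending-sound : ∀ k w → All (Ascending k w) (ascending k w)
ascending-sound zero    w       = (refl , [] , []) ∷ []
ascending-sound (suc k) zero    =
  (length-replicate (suc k) , linked-replicate ≤-refl (suc k) , All.replicate⁺ (suc k) z≤n) ∷ []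
ascending-sound (suc k) (suc w) = All.++⁺
  (All.map⁺ (All.map (λ { (l , asc , bnd) → cong suc l , linked-0∷ asc , z≤n ∷ bnd })
                     (ascending-sound k (suc w))))
  (All.map⁺ (All.map (λ { {s} (l , asc , bnd) → trans (length-map suc s) l
                                              , Linked.map⁺ (Linked.map s≤s asc)
                                              , All.map⁺ (All.map s≤s bnd) })
                     (ascending-sound (suc k) w)))

ascending-complete : ∀ k w s → Ascending k w s → s ∈ ascending k w
ascending-complete zero    w       []          _ = here refl
ascending-complete (suc k) zero    s           (l , _ , s≤0) =
  here (trans (all-≤0⇒replicate s s≤0) (cong (λ n → replicate n 0) l))
ascending-complete (suc k) (suc w) (zero ∷ s)  (l , asc , _ ∷ bnd) =
  ∈-++⁺ˡ (∈-map⁺ (0 ∷_) (ascending-complete k (suc w) s (suc-injective l , Linked.tail asc , bnd)))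
ascending-complete (suc k) (suc w) s@(suc _ ∷ _) (l , asc , bnd) =
  subst (_∈ ascending (suc k) (suc w)) map-suc-pred
    (∈-++⁺ʳ (map (0 ∷_) (ascending k (suc w)))
      (∈-map⁺ (map suc) (ascending-complete (suc k) w (map pred s)
        (trans (length-map pred s) l , Linked.map⁺ (Linked.map pred-mono-≤ asc) ,
         All.map⁺ (All.map pred-mono-≤ bnd)))))
  where
  map-suc-pred : map suc (map pred s) ≡ s
  map-suc-pred = trans (sym (map-∘ s))
    (trans (map-cong-local (All.map (λ { {suc _} _ → refl }) (Linked.Linked⇒All ≤-trans (s≤s z≤n) asc)))
           (map-id s))

ascending-unique : ∀ k w → Unique (ascending k w)
ascending-unique zero    w       = [] ∷ []
ascending-unique (suc k) zero    = [] ∷ []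
ascending-unique (suc k) (suc w) =
  Unique.++⁺ (Unique.map⁺ ∷-injectiveʳ (ascending-unique k (suc w)))
             (Unique.map⁺ (map-injective suc-injective) (ascending-unique (suc k) w))
             disjoint
  where
  disjoint : ∀ {v} → ¬ (v ∈ map (0 ∷_) (ascending k (suc w)) × v ∈ map (map suc) (ascending (suc k) w))
  disjoint (v∈l , v∈r) with ∈-map⁻ (0 ∷_) v∈l | ∈-map⁻ (map suc) v∈r
  ... | _ , _ , refl | []    , _ , ()
  ... | _ , _ , refl | _ ∷ _ , _ , ()

occurrences-sum-ascending : ∀ k w n → occurrences (map sum (ascending k w)) n ≡ coeff (gauss (w + k) k) n
occurrences-sum-ascending zero    w n rewrite +-identityʳ w =
  trans (+-identityʳ (monomial 0 n)) (sym (coeff-gauss-0 w n))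
occurrences-sum-ascending (suc k) zero n = begin
  monomial (sum (replicate k 0)) n + 0 ≡⟨ +-identityʳ _ ⟩
  monomial (sum (replicate k 0)) n     ≡⟨ cong (λ x → monomial x n) (trans (sum-replicate k 0) (*-zeroʳ k)) ⟩
  monomial 0 n                         ≡⟨ coeff-gauss-diag (suc k) n ⟨
  coeff (gauss (suc k) (suc k)) n      ∎
  where open ≡-Reasoning
occurrences-sum-ascending (suc k) (suc w) n = begin
  occurrences (map sum (map (0 ∷_) lower ++ map (map suc) upper)) n
    ≡⟨ cong (λ xs → occurrences xs n) (map-++ sum (map (0 ∷_) lower) _) ⟩
  occurrences (map sum (map (0 ∷_) lower) ++ map sum (map (map suc) upper)) n
    ≡⟨ occurrences-++ (map sum (map (0 ∷_) lower)) _ n ⟩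
  occurrences (map sum (map (0 ∷_) lower)) n + occurrences (map sum (map (map (1 +_)) upper)) n
    ≡⟨ cong₂ _+_ (trans (cong (λ xs → occurrences xs n) (sym (map-∘ lower))) (occurrences-sum-ascending k (suc w) n))
                 (occurrences-sum-map-add 1 (suc k) upper (All.map proj₁ (ascending-sound (suc k) w)) n) ⟩
  coeff (gauss (suc w + k) k) n + shifted (suc k * 1) (occurrences (map sum upper)) n
    ≡⟨ cong₂ _+_ (cong (λ m → coeff (gauss m k) n) (sym (+-suc w k)))
                 (trans (cong (λ d → shifted d (occurrences (map sum upper)) n) (*-identityʳ (suc k)))
                        (shifted-cong (suc k) (occurrences-sum-ascending (suc k) w) n)) ⟩
  coeff (gauss (w + suc k) k) n + shifted (suc k) (coeff (gauss (w + suc k) (suc k))) n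
    ≡⟨ coeff-gauss-pascal (w + suc k) k n ⟨
  coeff (gauss (suc w + suc k) (suc k)) n ∎
  where
  open ≡-Reasoning
  lower upper : List (List ℕ)
  lower = ascending k (suc w)
  upper = ascending (suc k) w

window : ℕ → ℕ → ℕ → List (List ℕ)
window k L w = map (map (L +_)) (ascending k w)

InWindow : ℕ → ℕ → ℕ → List ℕ → Set
InWindow k L w B = length B ≡ k × Linked _≤_ B × All (λ x → L ≤ x × x ≤ L + w) B

window-sound : ∀ k L w {B} → B ∈ window k L w → InWindow k L w B
window-sound k L w B∈ with ∈-map⁻ (map (L +_)) B∈
... | s , s∈ , refl with All.lookup (ascending-sound k w) s∈
... | length≡ , asc , bnd = trans (length-map (L +_) s) length≡
                          , Linked.map⁺ (Linked.map (+-monoʳ-≤ L) asc)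
                          , All.map⁺ (All.map (λ {x} x≤w → m≤m+n L x , +-monoʳ-≤ L x≤w) bnd)

window-complete : ∀ k L w {B} → InWindow k L w B → B ∈ window k L w
window-complete k L w {B} (length≡ , asc , bnd) =
  subst (_∈ window k L w) L+[B-L]≡B
    (∈-map⁺ (map (L +_)) (ascending-complete k w (map (_∸ L) B)
      ( trans (length-map (_∸ L) B) length≡
      , Linked.map⁺ (Linked.map (∸-monoˡ-≤ L) asc)
      , All.map⁺ (All.map (λ { {x} (_ , x≤L+w) → subst (x ∸ L ≤_) (m+n∸m≡n L w) (∸-monoˡ-≤ L x≤L+w) }) bnd))))
  where
  L+[B-L]≡B : map (L +_) (map (_∸ L) B) ≡ B
  L+[B-L]≡B = trans (sym (map-∘ B)) (trans (map-cong-local (All.map (m+[n∸m]≡n ∘ proj₁) bnd)) (map-id B))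

window-unique : ∀ k L w → Unique (window k L w)
window-unique k L w = Unique.map⁺ (map-injective (+-cancelˡ-≡ L _ _)) (ascending-unique k w)

occurrences-sum-window : ∀ k L w n →
  occurrences (map sum (window k L w)) n ≡ shifted (k * L) (coeff (gauss (w + k) k)) n
occurrences-sum-window k L w n =
  trans (occurrences-sum-map-add L k (ascending k w) (All.map proj₁ (ascending-sound k w)) n)
        (shifted-cong (k * L) (occurrences-sum-ascending k w) n)

-- Concatenating one list from each of two families convolves their generating polynomials

appendProduct : List (List ℕ) → List (List ℕ) → List (List ℕ)
appendProduct = cartesianProductWith (λ xs ys → ys ++ xs)

occurrences-sum-appendProduct : ∀ xss yss n →
  occurrences (map sum (appendProduct xss yss)) n
    ≡ convolve (occurrences (map sum xss)) (occurrences (map sum yss)) n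
occurrences-sum-appendProduct []         yss n = sym (convolve-zeroˡ _ _ (λ _ → refl) n)
occurrences-sum-appendProduct (xs ∷ xss) yss n = begin
  occurrences (map sum (map (_++ xs) yss ++ appendProduct xss yss)) n
    ≡⟨ cong (λ zs → occurrences zs n) (map-++ sum (map (_++ xs) yss) _) ⟩
  occurrences (map sum (map (_++ xs) yss) ++ map sum (appendProduct xss yss)) n
    ≡⟨ occurrences-++ (map sum (map (_++ xs) yss)) _ n ⟩
  occurrences (map sum (map (_++ xs) yss)) n + occurrences (map sum (appendProduct xss yss)) n
    ≡⟨ cong₂ _+_ (trans (cong (λ zs → occurrences zs n) sums) (occurrences-map-+ (sum xs) (map sum yss) n))
                 (occurrences-sum-appendProduct xss yss n) ⟩
  shifted (sum xs) g n + convolve f g n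
    ≡⟨ cong (_+ convolve f g n) (convolve-monomialˡ (sum xs) g n) ⟨
  convolve (monomial (sum xs)) g n + convolve f g n
    ≡⟨ convolve-distribʳ-+ (monomial (sum xs)) f g n ⟨
  convolve (occurrences (map sum (xs ∷ xss))) g n ∎
  where
  open ≡-Reasoning
  f g : ℕ → ℕ
  f = occurrences (map sum xss)
  g = occurrences (map sum yss)
  sums : map sum (map (_++ xs) yss) ≡ map (sum xs +_) (map sum yss)
  sums = trans (sym (map-∘ yss))
    (trans (map-cong-local (All.universal (λ ys → trans (sum-++ ys xs) (+-comm (sum ys) (sum xs))) yss))
           (map-∘ yss))

++-cancelʳ-sameLength : ∀ (xs ys : List ℕ) {us vs} → length xs ≡ length ys → xs ++ us ≡ ys ++ vs → us ≡ vs
++-cancelʳ-sameLength []       []       _   eq = eq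
++-cancelʳ-sameLength (x ∷ xs) (y ∷ ys) len eq =
  ++-cancelʳ-sameLength xs ys (suc-injective len) (∷-injectiveʳ eq)

appendProduct-unique : ∀ c xss yss → Unique xss → Unique yss → All (λ ys → length ys ≡ c) yss →
  Unique (appendProduct xss yss)
appendProduct-unique c []         yss _              _      _       = []
appendProduct-unique c (xs ∷ xss) yss (xs∉xss ∷ uxs) uys lengths =
  Unique.++⁺ (Unique.map⁺ (λ {ys} {zs} → ++-cancelʳ xs ys zs) uys)
             (appendProduct-unique c xss yss uxs uys lengths) disjoint
  where
  disjoint : ∀ {v} → ¬ (v ∈ map (_++ xs) yss × v ∈ appendProduct xss yss)
  disjoint (v∈l , v∈r) with ∈-map⁻ (_++ xs) v∈l | ∈-cartesianProductWith⁻ (λ xs ys → ys ++ xs) xss yss v∈r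
  ... | ys , ys∈ , refl | xs' , zs , xs'∈ , zs∈ , eq =
    All.lookup xs∉xss xs'∈
      (++-cancelʳ-sameLength ys zs (trans (All.lookup lengths ys∈) (sym (All.lookup lengths zs∈))) eq)

at-++ˡ : ∀ xs ys i → i < length xs → at (xs ++ ys) i ≡ at xs i
at-++ˡ (x ∷ xs) ys zero    _         = refl
at-++ˡ (x ∷ xs) ys (suc i) (s≤s i<n) = at-++ˡ xs ys i i<n

at-++ʳ : ∀ xs ys i → at (xs ++ ys) (length xs + i) ≡ at ys i
at-++ʳ []       ys i = refl
at-++ʳ (x ∷ xs) ys i = at-++ʳ xs ys i

at-take : ∀ (xs : List ℕ) n i → i < n → at (take n xs) i ≡ at xs i
at-take []       zero    i       _         = refl
at-take []       (suc n) i       _         = refl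
at-take (x ∷ xs) (suc n) zero    _         = refl
at-take (x ∷ xs) (suc n) (suc i) (s≤s i<n) = at-take xs n i i<n

at-drop : ∀ (xs : List ℕ) n i → at (drop n xs) i ≡ at xs (n + i)
at-drop xs       zero    i = refl
at-drop []       (suc n) i = refl
at-drop (x ∷ xs) (suc n) i = at-drop xs n i

take-suc-at : ∀ (xs : List ℕ) n → n < length xs → take (suc n) xs ≡ take n xs ++ at xs n ∷ []
take-suc-at (x ∷ xs) zero    _         = refl
take-suc-at (x ∷ xs) (suc n) (s≤s n<l) = cong (x ∷_) (take-suc-at xs n n<l)

All-at⁺ : ∀ {P : ℕ → Set} xs → (∀ i → i < length xs → P (at xs i)) → All P xs
All-at⁺ []       f = []
All-at⁺ (x ∷ xs) f = f 0 (s≤s z≤n) ∷ All-at⁺ xs (λ i i<n → f (suc i) (s≤s i<n))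

All-at⁻ : ∀ {P : ℕ → Set} xs → All P xs → ∀ i → i < length xs → P (at xs i)
All-at⁻ (x ∷ xs) (px ∷ pxs) zero    _         = px
All-at⁻ (x ∷ xs) (px ∷ pxs) (suc i) (s≤s i<n) = All-at⁻ xs pxs i i<n

Linked-at⁺ : ∀ {R : ℕ → ℕ → Set} xs → (∀ i → suc i < length xs → R (at xs i) (at xs (suc i))) →
  Linked R xs
Linked-at⁺ []           f = []
Linked-at⁺ (x ∷ [])     f = [-]
Linked-at⁺ (x ∷ y ∷ xs) f = f 0 (s≤s (s≤s z≤n)) ∷ Linked-at⁺ (y ∷ xs) (λ i i<n → f (suc i) (s≤s i<n))

Linked-at⁻ : ∀ {R : ℕ → ℕ → Set} xs → Linked R xs → ∀ i → suc i < length xs → R (at xs i) (at xs (suc i))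
Linked-at⁻ (x ∷ [])     [-]      zero    (s≤s ())
Linked-at⁻ (x ∷ y ∷ xs) (r ∷ rs) zero    _         = r
Linked-at⁻ (x ∷ y ∷ xs) (r ∷ rs) (suc i) (s≤s i<n) = Linked-at⁻ (y ∷ xs) rs i i<n

labels : ℕ → List ℕ
labels zero    = []
labels (suc M) = labels M ++ suc M ∷ []

length-labels : ∀ M → length (labels M) ≡ M
length-labels zero    = refl
length-labels (suc M) = trans (length-++ (labels M)) (trans (cong (_+ 1) (length-labels M)) (+-comm M 1))

∈-labels⁺ : ∀ M {l} → 1 ≤ l → l ≤ M → l ∈ labels M
∈-labels⁺ zero    {suc l} _ ()
∈-labels⁺ (suc M) {l} 1≤l l≤M with l ≟ suc M
... | yes refl = ∈-++⁺ʳ (labels M) (here refl)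
... | no  l≢   = ∈-++⁺ˡ (∈-labels⁺ M 1≤l (≤-pred (≤∧≢⇒< l≤M l≢)))

∈-labels⁻ : ∀ M {l} → l ∈ labels M → 1 ≤ l × l ≤ M
∈-labels⁻ (suc M) l∈ with ∈-++⁻ (labels M) l∈
... | inj₁ l∈′        = let 1≤l , l≤M = ∈-labels⁻ M l∈′ in 1≤l , m≤n⇒m≤1+n l≤M
... | inj₂ (here refl) = s≤s z≤n , ≤-refl

labels-unique : ∀ M → Unique (labels M)
labels-unique zero    = []
labels-unique (suc M) = Unique.++⁺ (labels-unique M) ([] ∷ []) disjoint
  where
  disjoint : ∀ {v} → ¬ (v ∈ labels M × v ∈ suc M ∷ [])
  disjoint (v∈ , here refl) = <-irrefl refl (proj₂ (∈-labels⁻ M v∈))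

-- Labels are 1-based while indices into a list are 0-based.
_!_ : List ℕ → ℕ → ℕ
σ ! l = at σ (l ∸ 1)

map-labels-! : ∀ σ M → M ≤ length σ → map (σ !_) (labels M) ≡ take M σ
map-labels-! σ zero    _   = refl
map-labels-! σ (suc M) M<l = begin
  map (σ !_) (labels M ++ suc M ∷ [])      ≡⟨ map-++ (σ !_) (labels M) _ ⟩
  map (σ !_) (labels M) ++ at σ M ∷ []     ≡⟨ cong (_++ at σ M ∷ []) (map-labels-! σ M (<⇒≤ M<l)) ⟩
  take M σ ++ at σ M ∷ []                  ≡⟨ take-suc-at σ M M<l ⟨
  take (suc M) σ                           ∎
  where open ≡-Reasoning

map-labels-!-length : ∀ σ → map (σ !_) (labels (length σ)) ≡ σ
map-labels-!-length σ = trans (map-labels-! σ (length σ) ≤-refl) (take-all (length σ) σ ≤-refl)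

length-map-labels : ∀ (f : ℕ → ℕ) M → length (map f (labels M)) ≡ M
length-map-labels f M = trans (length-map f (labels M)) (length-labels M)

at-map-labels : ∀ (f : ℕ → ℕ) M i → i < M → at (map f (labels M)) i ≡ f (suc i)
at-map-labels f (suc M) i i<1+M rewrite map-++ f (labels M) (suc M ∷ []) with i <? M
... | yes i<M = trans (at-++ˡ (map f (labels M)) _ i (subst (i <_) (sym (length-map-labels f M)) i<M))
                      (at-map-labels f M i i<M)
... | no  i≮M rewrite ≤-antisym (≤-pred i<1+M) (≮⇒≥ i≮M) =
  subst (λ k → at (map f (labels M) ++ f (suc M) ∷ []) k ≡ f (suc M))
        (trans (+-identityʳ _) (length-map-labels f M))
        (at-++ʳ (map f (labels M)) (f (suc M) ∷ []) 0)

!-map-labels : ∀ (f : ℕ → ℕ) M {l} → 1 ≤ l → l ≤ M → map f (labels M) ! l ≡ f l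
!-map-labels f M {suc l} _ l<M = at-map-labels f M l l<M

Nonincreasing : List ℕ → Set
Nonincreasing = Linked (λ x y → y ≤ x)

all≤head : ∀ {x xs} → Nonincreasing (x ∷ xs) → All (_≤ x) (x ∷ xs)
all≤head = Linked.Linked⇒All (λ y≤x z≤y → ≤-trans z≤y y≤x) ≤-refl

part≤head : ∀ {x xs} → Nonincreasing (x ∷ xs) → ∀ j → part xs j ≤ x
part≤head {x} {[]}     dec           j             = z≤n
part≤head {x} {y ∷ xs} dec           zero          = z≤n
part≤head {x} {y ∷ xs} (y≤x ∷ dec) (suc zero)    = y≤x
part≤head {x} {y ∷ xs} (y≤x ∷ dec) (suc (suc j)) = ≤-trans (part≤head dec (suc j)) y≤x

part-suc≤part : ∀ {lam} → Nonincreasing lam → ∀ j → 1 ≤ j → part lam (suc j) ≤ part lam j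
part-suc≤part {[]}     dec j             _ = z≤n
part-suc≤part {x ∷ xs} dec (suc zero)    _ = part≤head dec 1
part-suc≤part {x ∷ xs} dec (suc (suc j)) _ = part-suc≤part (Linked.tail dec) (suc j) (s≤s z≤n)

part-antitone : ∀ {lam} → Nonincreasing lam → ∀ {i j} → 1 ≤ i → i ≤ j → part lam j ≤ part lam i
part-antitone dec {suc i} {zero}  _   ()
part-antitone dec {i} {suc j} 1≤i i≤1+j with i ≟ suc j
... | yes refl = ≤-refl
... | no  i≢   = ≤-trans (part-suc≤part dec j (≤-trans 1≤i i≤j)) (part-antitone dec 1≤i i≤j)
  where
  i≤j : i ≤ j
  i≤j = ≤-pred (≤∧≢⇒< i≤1+j i≢)

part-beyond : ∀ lam j → length lam < j → part lam j ≡ 0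
part-beyond []       j             _         = refl
part-beyond (x ∷ xs) (suc (suc j)) (s≤s l<j) = part-beyond xs (suc j) l<j

length≤sum : ∀ lam → All (1 ≤_) lam → length lam ≤ sum lam
length≤sum []       []          = z≤n
length≤sum (x ∷ xs) (1≤x ∷ pos) = +-mono-≤ 1≤x (length≤sum xs pos)

conj-accept : ∀ {x xs l} → l ≤ x → conj (x ∷ xs) l ≡ suc (conj xs l)
conj-accept {l = l} l≤x = cong length (filter-accept (l ≤?_) l≤x)

conj-reject : ∀ {x xs l} → ¬ l ≤ x → conj (x ∷ xs) l ≡ conj xs l
conj-reject {l = l} l≰x = cong length (filter-reject (l ≤?_) l≰x)

conj-∷ : ∀ x xs l → conj (x ∷ xs) l ≡ conj (x ∷ []) l + conj xs l
conj-∷ x xs l with l ≤? x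
... | yes l≤x = trans (conj-accept l≤x) (cong (_+ conj xs l) (sym (conj-accept {xs = []} l≤x)))
... | no  l≰x = trans (conj-reject l≰x) (cong (_+ conj xs l) (sym (conj-reject {xs = []} l≰x)))

conj-head< : ∀ {lam} → Nonincreasing lam → ∀ {l} → part lam 1 < l → conj lam l ≡ 0
conj-head< {[]}     dec       _   = refl
conj-head< {x ∷ xs} dec {l} x<l =
  cong length (filter-none (l ≤?_) (All.map (λ y≤x → <⇒≱ (≤-<-trans y≤x x<l)) (all≤head dec)))

part-≥⇒conj-≥ : ∀ {lam} → Nonincreasing lam → ∀ {l} j → 1 ≤ l → 1 ≤ j → l ≤ part lam j → j ≤ conj lam l
part-≥⇒conj-≥ {[]}     dec {suc l} j _ _ ()
part-≥⇒conj-≥ {x ∷ xs} dec (suc zero) _ _ l≤x rewrite conj-accept {xs = xs} l≤x = s≤s z≤n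
part-≥⇒conj-≥ {x ∷ xs} dec (suc (suc j)) 1≤l _ l≤λ
  rewrite conj-accept {xs = xs} (≤-trans l≤λ (part≤head dec (suc j))) =
  s≤s (part-≥⇒conj-≥ (Linked.tail dec) (suc j) 1≤l (s≤s z≤n) l≤λ)

conj-≥⇒part-≥ : ∀ {lam} → Nonincreasing lam → ∀ {l} j → 1 ≤ j → j ≤ conj lam l → l ≤ part lam j
conj-≥⇒part-≥ {[]}     dec (suc j) _ ()
conj-≥⇒part-≥ {x ∷ xs} dec {l} j 1≤j j≤λ′ with l ≤? x
conj-≥⇒part-≥ {x ∷ xs} dec (suc zero) _ _ | yes l≤x = l≤x
conj-≥⇒part-≥ {x ∷ xs} dec (suc (suc j)) _ j≤λ′ | yes l≤x rewrite conj-accept {xs = xs} l≤x =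
  conj-≥⇒part-≥ (Linked.tail dec) (suc j) (s≤s z≤n) (≤-pred j≤λ′)
... | no l≰x = contradiction (subst (j ≤_) (conj-head< dec (≰⇒> l≰x)) j≤λ′) (<⇒≱ 1≤j)

conj≡ : ∀ {lam} → Nonincreasing lam → ∀ {l j} → 1 ≤ l → 1 ≤ j →
  part lam (suc j) < l → l ≤ part lam j → conj lam l ≡ j
conj≡ {lam} dec {l} {j} 1≤l 1≤j λⱼ₊₁<l l≤λⱼ = ≤-antisym conj≤j (part-≥⇒conj-≥ dec j 1≤l 1≤j l≤λⱼ)
  where
  conj≤j : conj lam l ≤ j
  conj≤j with conj lam l ≤? j
  ... | yes ≤j = ≤j
  ... | no  ≰j = contradiction (conj-≥⇒part-≥ dec (suc j) (s≤s z≤n) (≰⇒> ≰j)) (<⇒≱ λⱼ₊₁<l)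

InBlock : List ℕ → ℕ → ℕ → Set
InBlock lam j l = 1 ≤ j × part lam (suc j) < l × l ≤ part lam j

inBlock-conj : ∀ {lam} → Nonincreasing lam → ∀ {l} → 1 ≤ l → l ≤ part lam 1 → InBlock lam (conj lam l) l
inBlock-conj {lam} dec {l} 1≤l l≤λ₁ = 1≤λ′ , λ₊₁<l , conj-≥⇒part-≥ dec (conj lam l) 1≤λ′ ≤-refl
  where
  1≤λ′ : 1 ≤ conj lam l
  1≤λ′ = part-≥⇒conj-≥ dec 1 1≤l ≤-refl l≤λ₁
  λ₊₁<l : part lam (suc (conj lam l)) < l
  λ₊₁<l with part lam (suc (conj lam l)) <? l
  ... | yes <l = <l
  ... | no  ≮l = contradiction (part-≥⇒conj-≥ dec (suc (conj lam l)) 1≤l (s≤s z≤n) (≮⇒≥ ≮l)) (<-irrefl refl)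

sum-map-++ : ∀ {A : Set} (f : A → ℕ) xs ys → sum (map f (xs ++ ys)) ≡ sum (map f xs) + sum (map f ys)
sum-map-++ f xs ys = trans (cong sum (map-++ f xs ys)) (sum-++ (map f xs) (map f ys))

sum-map-+ : ∀ (f g : ℕ → ℕ) xs → sum (map (λ x → f x + g x) xs) ≡ sum (map f xs) + sum (map g xs)
sum-map-+ f g []       = refl
sum-map-+ f g (x ∷ xs) = trans (cong (f x + g x +_) (sum-map-+ f g xs)) (interchange (f x) (g x) _ _)

sum-map-cong : ∀ {A : Set} {f g : A → ℕ} {xs} → All (λ x → f x ≡ g x) xs → sum (map f xs) ≡ sum (map g xs)
sum-map-cong f≗g = cong sum (map-cong-local f≗g)

sum-conj-singleton : ∀ M x → sum (map (conj (x ∷ [])) (labels M)) ≡ M ⊓ x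
sum-conj-singleton zero    x = refl
sum-conj-singleton (suc M) x rewrite sum-map-++ (conj (x ∷ [])) (labels M) (suc M ∷ []) | sum-conj-singleton M x
  with suc M ≤? x
... | yes M<x rewrite conj-accept {xs = []} M<x | m≤n⇒m⊓n≡m (<⇒≤ M<x) | m≤n⇒m⊓n≡m M<x = +-comm M 1
... | no  M≮x rewrite conj-reject {xs = []} M≮x | m≥n⇒m⊓n≡n (≤-pred (≰⇒> M≮x)) | m≥n⇒m⊓n≡n (<⇒≤ (≰⇒> M≮x)) =
  +-identityʳ x

sum-conj : ∀ lam M → All (_≤ M) lam → sum (map (conj lam) (labels M)) ≡ sum lam
sum-conj []       M _ = sum-zero (labels M)
  where
  sum-zero : ∀ ls → sum (map (conj []) ls) ≡ 0
  sum-zero []       = refl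
  sum-zero (l ∷ ls) = sum-zero ls
sum-conj (x ∷ xs) M (x≤M ∷ xs≤M) = begin
  sum (map (conj (x ∷ xs)) (labels M))
    ≡⟨ sum-map-cong (All.universal (conj-∷ x xs) (labels M)) ⟩
  sum (map (λ l → conj (x ∷ []) l + conj xs l) (labels M))
    ≡⟨ sum-map-+ (conj (x ∷ [])) (conj xs) (labels M) ⟩
  sum (map (conj (x ∷ [])) (labels M)) + sum (map (conj xs) (labels M))
    ≡⟨ cong₂ _+_ (trans (sum-conj-singleton M x) (m≥n⇒m⊓n≡n x≤M)) (sum-conj xs M xs≤M) ⟩
  x + sum xs ∎
  where open ≡-Reasoning

Y-suc : ∀ lam i → Y lam (suc i) ≡ Y lam i + part lam (suc i)
Y-suc []       zero    = refl
Y-suc []       (suc i) = refl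
Y-suc (x ∷ xs) zero    = +-identityʳ x
Y-suc (x ∷ xs) (suc i) = trans (cong (x +_) (Y-suc xs i)) (sym (+-assoc x (Y xs i) (part xs (suc i))))

*-part≤Y : ∀ {lam} → Nonincreasing lam → ∀ j → j * part lam j ≤ Y lam j
*-part≤Y {lam} dec zero    = z≤n
*-part≤Y {lam} dec (suc j) = begin
  suc j * part lam (suc j)           ≡⟨ +-comm (part lam (suc j)) _ ⟩
  j * part lam (suc j) + part lam (suc j) ≤⟨ +-monoˡ-≤ _ (≤-trans (j*λⱼ₊₁≤j*λⱼ j) (*-part≤Y dec j)) ⟩
  Y lam j + part lam (suc j)         ≡⟨ Y-suc lam j ⟨
  Y lam (suc j)                      ∎
  where
  open ≤-Reasoning
  j*λⱼ₊₁≤j*λⱼ : ∀ j → j * part lam (suc j) ≤ j * part lam j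
  j*λⱼ₊₁≤j*λⱼ zero    = z≤n
  j*λⱼ₊₁≤j*λⱼ (suc j) = *-monoʳ-≤ (suc j) (part-suc≤part dec (suc j) (s≤s z≤n))

-- The exponent 2 Σ_i binom(λ_i, 2), by summation by parts

falling2 : ℕ → ℕ
falling2 x = x * (x ∸ 1)

falling2-mono : ∀ {x y} → x ≤ y → falling2 x ≤ falling2 y
falling2-mono x≤y = *-mono-≤ x≤y (∸-monoˡ-≤ 1 x≤y)

falling2≡2*C2 : ∀ x → falling2 x ≡ 2 * (x C 2)
falling2≡2*C2 zero          = refl
falling2≡2*C2 (suc zero)    = refl
falling2≡2*C2 (suc (suc n)) = begin
  (2 + n) * (1 + n)          ≡⟨ solve 1 (λ n → (con 2 :+ n) :* (con 1 :+ n)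
                                           := con 2 :* (con 1 :+ n) :+ (con 1 :+ n) :* n) refl n ⟩
  2 * suc n + falling2 (suc n) ≡⟨ cong (2 * suc n +_) (falling2≡2*C2 (suc n)) ⟩
  2 * suc n + 2 * (suc n C 2) ≡⟨ *-distribˡ-+ 2 (suc n) (suc n C 2) ⟨
  2 * (suc n + suc n C 2)     ≡⟨ cong (λ m → 2 * (m + suc n C 2)) (nC1≡n (suc n)) ⟨
  2 * (suc n C 1 + suc n C 2) ≡⟨ cong (2 *_) (nCk+nC[k+1]≡[n+1]C[k+1] (suc n) 1) ⟩
  2 * (suc (suc n) C 2)       ∎
  where open ≡-Reasoning

∸*-falling2 : ∀ p q → q ≤ p → (p ∸ q) * (p + q ∸ 1) ≡ falling2 p ∸ falling2 q
∸*-falling2 p q q≤p with m≤n⇒∃[o]m+o≡n q≤p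
... | k , refl = begin
  (q + k ∸ q) * (q + k + q ∸ 1)                 ≡⟨ cong₂ _*_ (m+n∸m≡n q k) (cong (_∸ 1) (+-comm (q + k) q)) ⟩
  k * (q + (q + k) ∸ 1)                         ≡⟨ m+n∸n≡m _ (falling2 q) ⟨
  k * (q + (q + k) ∸ 1) + falling2 q ∸ falling2 q ≡⟨ cong (_∸ falling2 q) (expand q k) ⟩
  falling2 (q + k) ∸ falling2 q                 ∎
  where
  open ≡-Reasoning
  expand : ∀ q k → k * (q + (q + k) ∸ 1) + falling2 q ≡ falling2 (q + k)
  expand q       zero    = cong falling2 (sym (+-identityʳ q))
  expand zero    (suc k) = +-identityʳ _
  expand (suc q) (suc k) = solve 2 (λ q k → (con 1 :+ k) :* (q :+ (con 1 :+ (q :+ (con 1 :+ k))))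
                                              :+ (con 1 :+ q) :* q
                                         := (con 1 :+ (q :+ (con 1 :+ k))) :* (q :+ (con 1 :+ k))) refl q k

-- (λ_j − λ_{j+1}) · j (λ_j + λ_{j+1} − 1): the least size of the rows with labels in block j.
blockShift : List ℕ → ℕ → ℕ
blockShift lam j = (part lam j ∸ part lam (suc j)) * (j * (part lam j + part lam (suc j) ∸ 1))

blockShift≡ : ∀ {lam} → Nonincreasing lam → ∀ j → 1 ≤ j →
  blockShift lam j ≡ j * (falling2 (part lam j) ∸ falling2 (part lam (suc j)))
blockShift≡ {lam} dec j 1≤j = trans
  (solve 3 (λ k j x → k :* (j :* x) := j :* (k :* x)) refl (part lam j ∸ part lam (suc j)) j _)
  (cong (j *_) (∸*-falling2 (part lam j) (part lam (suc j)) (part-suc≤part dec j 1≤j)))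

sumFrom : (ℕ → ℕ) → ℕ → ℕ → ℕ
sumFrom f j zero    = 0
sumFrom f j (suc m) = f j + sumFrom f (suc j) m

falling2-parts : List ℕ → ℕ → ℕ
falling2-parts lam i = falling2 (part lam i)

sumFrom-falling2-parts : ∀ lam m → length lam ≤ m → sumFrom (falling2-parts lam) 1 m ≡ sum (map falling2 lam)
sumFrom-falling2-parts []       m       _         = zeros 1 m
  where
  zeros : ∀ j m → sumFrom (falling2-parts []) j m ≡ 0
  zeros j zero    = refl
  zeros j (suc m) = zeros (suc j) m
sumFrom-falling2-parts (x ∷ xs) (suc m) (s≤s l≤m) =
  cong (falling2 x +_) (trans (dropHead 0 m) (sumFrom-falling2-parts xs m l≤m))
  where
  dropHead : ∀ j m → sumFrom (falling2-parts (x ∷ xs)) (suc (suc j)) m ≡ sumFrom (falling2-parts xs) (suc j) m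
  dropHead j zero    = refl
  dropHead j (suc m) = cong (falling2 (part xs (suc j)) +_) (dropHead (suc j) m)

sumFrom-blockShift : ∀ {lam} → Nonincreasing lam → ∀ j m →
  sumFrom (blockShift lam) (suc j) m + (j + m) * falling2 (part lam (suc j + m))
    ≡ j * falling2 (part lam (suc j)) + sumFrom (falling2-parts lam) (suc j) m
sumFrom-blockShift {lam} dec j zero    =
  trans (cong (λ i → i * falling2 (part lam (suc i))) (+-identityʳ j)) (sym (+-identityʳ _))
sumFrom-blockShift {lam} dec j (suc m) = begin
  blockShift lam (suc j) + rest + (j + suc m) * G (suc j + suc m)
    ≡⟨ cong₂ (λ b k → b + rest + k * G (suc k)) (blockShift≡ dec (suc j) (s≤s z≤n)) (+-suc j m) ⟩
  suc j * (G₁ ∸ G₂) + rest + (suc j + m) * G (suc (suc j) + m)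
    ≡⟨ +-assoc (suc j * (G₁ ∸ G₂)) rest _ ⟩
  suc j * (G₁ ∸ G₂) + (rest + (suc j + m) * G (suc (suc j) + m))
    ≡⟨ cong (suc j * (G₁ ∸ G₂) +_) (sumFrom-blockShift dec (suc j) m) ⟩
  suc j * (G₁ ∸ G₂) + (suc j * G₂ + falls)
    ≡⟨ +-assoc (suc j * (G₁ ∸ G₂)) (suc j * G₂) falls ⟨
  suc j * (G₁ ∸ G₂) + suc j * G₂ + falls
    ≡⟨ cong (_+ falls) (*-distribˡ-+ (suc j) (G₁ ∸ G₂) G₂) ⟨
  suc j * (G₁ ∸ G₂ + G₂) + falls
    ≡⟨ cong (λ g → suc j * g + falls) (m∸n+n≡m (falling2-mono (part-suc≤part dec (suc j) (s≤s z≤n)))) ⟩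
  suc j * G₁ + falls
    ≡⟨ solve 3 (λ j g s → (con 1 :+ j) :* g :+ s := j :* g :+ (g :+ s)) refl j G₁ falls ⟩
  j * G₁ + (G₁ + falls) ∎
  where
  open ≡-Reasoning
  G : ℕ → ℕ
  G = falling2-parts lam
  G₁ G₂ rest falls : ℕ
  G₁ = G (suc j)
  G₂ = G (suc (suc j))
  rest = sumFrom (blockShift lam) (suc (suc j)) m
  falls = sumFrom G (suc (suc j)) m

balanced : ℕ → ℕ → List ℕ
balanced zero    s = []
balanced (suc c) s = replicate (s % suc c) (suc (s / suc c)) ++ replicate (suc c ∸ s % suc c) (s / suc c)

length-balanced : ∀ c s → length (balanced c s) ≡ c
length-balanced zero    s = refl
length-balanced (suc c) s = begin
  length (replicate r (suc q) ++ replicate (suc c ∸ r) q) ≡⟨ length-++ (replicate r (suc q)) ⟩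
  length (replicate r (suc q)) + length (replicate (suc c ∸ r) q)
    ≡⟨ cong₂ _+_ (length-replicate r) (length-replicate (suc c ∸ r)) ⟩
  r + (suc c ∸ r)                                       ≡⟨ m+[n∸m]≡n (<⇒≤ (m%n<n s (suc c))) ⟩
  suc c                                                 ∎
  where
  open ≡-Reasoning
  r q : ℕ
  r = s % suc c
  q = s / suc c

sum-two-values : ∀ t u v → sum (replicate t (suc v) ++ replicate u v) ≡ t + (t + u) * v
sum-two-values t u v = begin
  sum (replicate t (suc v) ++ replicate u v) ≡⟨ sum-++ (replicate t (suc v)) _ ⟩
  sum (replicate t (suc v)) + sum (replicate u v) ≡⟨ cong₂ _+_ (sum-replicate t (suc v)) (sum-replicate u v) ⟩
  t * suc v + u * v ≡⟨ solve 3 (λ t u v → t :* (con 1 :+ v) :+ u :* v := t :+ (t :+ u) :* v) refl t u v ⟩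
  t + (t + u) * v ∎
  where open ≡-Reasoning

sum-balanced : ∀ c s → 1 ≤ c → sum (balanced c s) ≡ s
sum-balanced (suc c) s _ = begin
  sum (replicate r (suc q) ++ replicate (d ∸ r) q) ≡⟨ sum-two-values r (d ∸ r) q ⟩
  r + (r + (d ∸ r)) * q                            ≡⟨ cong (λ z → r + z * q) (m+[n∸m]≡n (<⇒≤ (m%n<n s d))) ⟩
  r + d * q                                        ≡⟨ cong (r +_) (*-comm d q) ⟩
  r + q * d                                        ≡⟨ m≡m%n+[m/n]*n s d ⟨
  s                                                ∎
  where
  open ≡-Reasoning
  d r q : ℕ
  d = suc c
  r = s % d
  q = s / d

balanced-two-values : ∀ t u v → balanced (t + suc u) (t + (t + suc u) * v) ≡ replicate t (suc v) ++ replicate (suc u) v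
balanced-two-values t u v rewrite +-suc t u = begin
  balanced d (t + d * v)
    ≡⟨ cong₂ (λ r q → replicate r (suc q) ++ replicate (d ∸ r) q) rem quo ⟩
  replicate t (suc v) ++ replicate (d ∸ t) v
    ≡⟨ cong (λ n → replicate t (suc v) ++ replicate n v) (trans (cong (_∸ t) (sym (+-suc t u))) (m+n∸m≡n t (suc u))) ⟩
  replicate t (suc v) ++ replicate (suc u) v ∎
  where
  open ≡-Reasoning
  d : ℕ
  d = suc (t + u)
  rem : (t + d * v) % d ≡ t
  rem = trans (cong (λ z → (t + z) % d) (*-comm d v)) (trans ([m+kn]%n≡m%n t v d) (m<n⇒m%n≡m (s≤s (m≤m+n t u))))
  quo : (t + d * v) / d ≡ v
  quo = *-cancelʳ-≡ _ _ d (+-cancelˡ-≡ t _ _ (begin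
    t + (t + d * v) / d * d               ≡⟨ cong (_+ (t + d * v) / d * d) rem ⟨
    (t + d * v) % d + (t + d * v) / d * d ≡⟨ m≡m%n+[m/n]*n (t + d * v) d ⟨
    t + d * v                             ≡⟨ cong (t +_) (*-comm d v) ⟩
    t + v * d                             ∎))

TwoValues : ℕ → ℕ → Set
TwoValues v y = y ≡ v ⊎ y ≡ suc v

twoValues : ∀ {v y} → v ≤ y → y ≤ suc v → TwoValues v y
twoValues {v} {y} v≤y y≤1+v with v <? y
... | yes v<y = inj₂ (≤-antisym y≤1+v v<y)
... | no  v≮y = inj₁ (≤-antisym (≮⇒≥ v≮y) v≤y)

balanced-twoValues : ∀ c s → All (TwoValues (s / suc c)) (balanced (suc c) s)
balanced-twoValues c s =
  All.++⁺ (All.replicate⁺ (s % suc c) (inj₂ refl)) (All.replicate⁺ (suc c ∸ s % suc c) (inj₁ refl))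

balanced-close : ∀ c s {x y} → x ∈ balanced c s → y ∈ balanced c s → x ≤ suc y
balanced-close (suc c) s x∈ y∈ with All.lookup (balanced-twoValues c s) x∈ | All.lookup (balanced-twoValues c s) y∈
... | inj₁ refl | inj₁ refl = n≤1+n _
... | inj₁ refl | inj₂ refl = ≤-trans (n≤1+n _) (n≤1+n _)
... | inj₂ refl | inj₁ refl = ≤-refl
... | inj₂ refl | inj₂ refl = n≤1+n _

balanced-lower : ∀ c s {L} → c * L ≤ s → All (L ≤_) (balanced c s)
balanced-lower zero    s     _    = []
balanced-lower (suc c) s {L} cL≤s = All.map (λ { (inj₁ refl) → L≤q ; (inj₂ refl) → ≤-trans L≤q (n≤1+n _) })
                                            (balanced-twoValues c s)
  where
  L≤q : L ≤ s / suc c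
  L≤q = subst (_≤ s / suc c) (m*n/n≡m L (suc c)) (/-monoˡ-≤ (suc c) (subst (_≤ s) (*-comm (suc c) L) cL≤s))

balanced-upper : ∀ c s {a} → s ≤ c * a → All (_≤ a) (balanced c s)
balanced-upper zero    s     _    = []
balanced-upper (suc c) s {a} s≤ca = All.++⁺ (upper (s % d) q+1≤a) (All.replicate⁺ (d ∸ s % d) q≤a)
  where
  d : ℕ
  d = suc c
  s≤aC : s ≤ a * d
  s≤aC = subst (s ≤_) (*-comm d a) s≤ca
  q≤a : s / d ≤ a
  q≤a = *-cancelʳ-≤ (s / d) a d (≤-trans (m/n*n≤m s d) s≤aC)
  q+1≤a : 1 ≤ s % d → suc (s / d) ≤ a
  q+1≤a 1≤r = *-cancelʳ-< d (s / d) a (<-≤-trans qC<s s≤aC)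
    where
    qC<s : s / d * d < s
    qC<s = subst (s / d * d <_) (sym (m≡m%n+[m/n]*n s d)) (+-monoˡ-< (s / d * d) 1≤r)
  upper : ∀ n → (1 ≤ n → suc (s / d) ≤ a) → All (_≤ a) (replicate n (suc (s / d)))
  upper zero    _ = []
  upper (suc n) f = All.replicate⁺ (suc n) (f (s≤s z≤n))

minimum-∈ : ∀ x xs → Σ ℕ λ m → m ∈ x ∷ xs × All (m ≤_) (x ∷ xs)
minimum-∈ x []       = x , here refl , ≤-refl ∷ []
minimum-∈ x (y ∷ xs) with minimum-∈ y xs
... | m , m∈ , m≤ with x ≤? m
... | yes x≤m = x , here refl , ≤-refl ∷ All.map (≤-trans x≤m) m≤
... | no  x≰m = m , there m∈ , <⇒≤ (≰⇒> x≰m) ∷ m≤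

twoValues-↭ : ∀ v xs → All (TwoValues v) xs →
  Σ ℕ λ t → Σ ℕ λ u → (xs ↭ replicate t (suc v) ++ replicate u v) × (v ∈ xs → 1 ≤ u)
twoValues-↭ v []       []               = 0 , 0 , ↭-refl , λ ()
twoValues-↭ v (y ∷ xs) (inj₁ refl ∷ tv) with twoValues-↭ v xs tv
... | t , u , xs↭ , _ =
  t , suc u , ↭-trans (prep v xs↭) (↭-sym (Perm.shift v (replicate t (suc v)) (replicate u v))) , λ _ → s≤s z≤n
twoValues-↭ v (y ∷ xs) (inj₂ refl ∷ tv) with twoValues-↭ v xs tv
... | t , u , xs↭ , v∈⇒ = suc t , u , prep (suc v) xs↭ ,
  λ { (here v≡) → contradiction v≡ (<⇒≢ (n<1+n v)) ; (there v∈) → v∈⇒ v∈ }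

balanced-↭ : ∀ xs → (∀ {x y} → x ∈ xs → y ∈ xs → x ≤ suc y) → xs ↭ balanced (length xs) (sum xs)
balanced-↭ []       _     = ↭-refl
balanced-↭ (x ∷ xs) close with minimum-∈ x xs
... | m , m∈ , m≤ with twoValues-↭ m (x ∷ xs) (All.tabulate (λ y∈ → twoValues (All.lookup m≤ y∈) (close y∈ m∈)))
... | t , zero  , _   , 1≤u = contradiction (1≤u m∈) (λ ())
... | t , suc u , xs↭ , _   =
  subst (x ∷ xs ↭_) (sym (trans (cong₂ balanced size≡ total) (balanced-two-values t u m))) xs↭
  where
  size≡ : length (x ∷ xs) ≡ t + suc u
  size≡ = trans (Perm.↭-length xs↭)
              (trans (length-++ (replicate t (suc m))) (cong₂ _+_ (length-replicate t) (length-replicate (suc u))))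
  total : sum (x ∷ xs) ≡ t + (t + suc u) * m
  total = trans (sum-↭ xs↭) (sum-two-values t (suc u) m)

-- A row of a modular diagram is determined by its length and its label.
Key : Set
Key = ℕ × ℕ

-- The order of the rows of a modular diagram: lengths decrease, and among rows of equal length
-- the labels decrease, by the column condition on their last cells.
_⊑_ : Key → Key → Set
(m , l) ⊑ (m' , l') = m' < m ⊎ (m ≡ m' × l' ≤ l)

⊑-reflexive : ∀ {k k'} → k ≡ k' → k ⊑ k'
⊑-reflexive refl = inj₂ (refl , ≤-refl)

⊑-trans : ∀ {k k' k''} → k ⊑ k' → k' ⊑ k'' → k ⊑ k''
⊑-trans (inj₁ p)          (inj₁ q)          = inj₁ (<-trans q p)
⊑-trans (inj₁ p)          (inj₂ (refl , _)) = inj₁ p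
⊑-trans (inj₂ (refl , _)) (inj₁ q)          = inj₁ q
⊑-trans (inj₂ (refl , p)) (inj₂ (refl , q)) = inj₂ (refl , ≤-trans q p)

⊑-antisym : ∀ {k k'} → k ⊑ k' → k' ⊑ k → k ≡ k'
⊑-antisym (inj₁ p)          (inj₁ q)          = contradiction p (<-asym q)
⊑-antisym (inj₁ p)          (inj₂ (refl , _)) = contradiction p (<-irrefl refl)
⊑-antisym (inj₂ (refl , _)) (inj₁ q)          = contradiction q (<-irrefl refl)
⊑-antisym (inj₂ (refl , p)) (inj₂ (_ , q))    = cong (_ ,_) (≤-antisym q p)

⊑-total : ∀ k k' → k ⊑ k' ⊎ k' ⊑ k
⊑-total (m , l) (m' , l') with <-cmp m m'
... | tri< m<m' _ _ = inj₂ (inj₁ m<m')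
... | tri> _ _ m'<m = inj₁ (inj₁ m'<m)
... | tri≈ _ refl _ with ≤-total l l'
... | inj₁ l≤l' = inj₂ (inj₂ (refl , l≤l'))
... | inj₂ l'≤l = inj₁ (inj₂ (refl , l'≤l))

_⊑?_ : ∀ k k' → Dec (k ⊑ k')
(m , l) ⊑? (m' , l') with m' <? m | m ≟ m' | l' ≤? l
... | yes m'<m | _        | _        = yes (inj₁ m'<m)
... | no  m'≮m | yes m≡m' | yes l'≤l = yes (inj₂ (m≡m' , l'≤l))
... | no  m'≮m | no  m≢m' | _        = no λ { (inj₁ m'<m) → m'≮m m'<m ; (inj₂ (m≡m' , _)) → m≢m' m≡m' }
... | no  m'≮m | yes _    | no  l'≰l = no λ { (inj₁ m'<m) → m'≮m m'<m ; (inj₂ (_ , l'≤l)) → l'≰l l'≤l }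

⊑-decTotalOrder : DecTotalOrder _ _ _
⊑-decTotalOrder = record
  { Carrier         = Key
  ; _≈_             = _≡_
  ; _≤_             = _⊑_
  ; isDecTotalOrder = record
    { isTotalOrder = record
      { isPartialOrder = record
        { isPreorder = record { isEquivalence = isEquivalence ; reflexive = ⊑-reflexive ; trans = ⊑-trans }
        ; antisym    = ⊑-antisym }
      ; total = ⊑-total }
    ; _≟_  = ≡-dec _≟_ _≟_
    ; _≤?_ = _⊑?_ } }

open import Data.List.Sort ⊑-decTotalOrder using (sort; sort-↭; sort-↗)

sorted-↭⇒≡ : ∀ {ks ks'} → Linked _⊑_ ks → Linked _⊑_ ks' → ks ↭ ks' → ks ≡ ks'
sorted-↭⇒≡ sorted sorted′ ks↭ =
  Pointwise-≡⇒≡ (↗↭↗⇒≋ (DecTotalOrder.totalOrder ⊑-decTotalOrder) sorted sorted′ (↭⇒↭ₛ ks↭))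

labelled? : ∀ l (k : Key) → Dec (proj₂ k ≡ l)
labelled? l k = proj₂ k ≟ l

filter-concatMap-∉ : ∀ (group : ℕ → List Key) ls {l} → (∀ l′ → All (λ k → proj₂ k ≡ l′) (group l′)) → l ∉ ls →
  filter (labelled? l) (concatMap group ls) ≡ []
filter-concatMap-∉ group []        grouped l∉ = refl
filter-concatMap-∉ group (l′ ∷ ls) {l} grouped l∉ = begin
  filter (labelled? l) (group l′ ++ concatMap group ls)
    ≡⟨ filter-++ (labelled? l) (group l′) _ ⟩
  filter (labelled? l) (group l′) ++ filter (labelled? l) (concatMap group ls)
    ≡⟨ cong₂ _++_ (filter-none (labelled? l) (All.map (λ l′≡ l≡ → l∉ (here (trans (sym l≡) l′≡))) (grouped l′)))
                  (filter-concatMap-∉ group ls grouped (l∉ ∘ there)) ⟩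
  [] ∎
  where open ≡-Reasoning

filter-concatMap-∈ : ∀ (group : ℕ → List Key) ls {l} → Unique ls → (∀ l′ → All (λ k → proj₂ k ≡ l′) (group l′)) →
  l ∈ ls → filter (labelled? l) (concatMap group ls) ≡ group l
filter-concatMap-∈ group (l ∷ ls) (l∉ls ∷ _) grouped (here refl) = begin
  filter (labelled? l) (group l ++ concatMap group ls)
    ≡⟨ filter-++ (labelled? l) (group l) _ ⟩
  filter (labelled? l) (group l) ++ filter (labelled? l) (concatMap group ls)
    ≡⟨ cong₂ _++_ (filter-all (labelled? l) (grouped l))
                  (filter-concatMap-∉ group ls grouped (λ l∈ → All.lookup l∉ls l∈ refl)) ⟩
  group l ++ []
    ≡⟨ ++-identityʳ (group l) ⟩
  group l ∎
  where open ≡-Reasoning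
filter-concatMap-∈ group (l′ ∷ ls) {l} (l′∉ls ∷ unique) grouped (there l∈) = begin
  filter (labelled? l) (group l′ ++ concatMap group ls)
    ≡⟨ filter-++ (labelled? l) (group l′) _ ⟩
  filter (labelled? l) (group l′) ++ filter (labelled? l) (concatMap group ls)
    ≡⟨ cong₂ _++_ (filter-none (labelled? l)
                    (All.map (λ l′≡ l≡ → All.lookup l′∉ls l∈ (trans (sym l′≡) l≡)) (grouped l′)))
                  (filter-concatMap-∈ group ls unique grouped l∈) ⟩
  group l ∎
  where open ≡-Reasoning

↭-filter++filter-¬ : ∀ {A : Set} {P : A → Set} (P? : ∀ x → Dec (P x)) xs → xs ↭ filter P? xs ++ filter (¬? ∘ P?) xs
↭-filter++filter-¬ P? []       = ↭-refl
↭-filter++filter-¬ P? (x ∷ xs) with P? x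
... | yes _ = prep x (↭-filter++filter-¬ P? xs)
... | no  _ = ↭-trans (prep x (↭-filter++filter-¬ P? xs)) (↭-sym (Perm.shift x (filter P? xs) _))

filter-labelled-¬labelled : ∀ (ks : List Key) {l l′} → l′ ≢ l →
  filter (labelled? l′) (filter (¬? ∘ labelled? l) ks) ≡ filter (labelled? l′) ks
filter-labelled-¬labelled []             l′≢l = refl
filter-labelled-¬labelled ((m , x) ∷ ks) {l} {l′} l′≢l with x ≟ l | x ≟ l′
... | yes refl | yes refl = contradiction refl l′≢l
... | yes refl | no  x≢l′ rewrite filter-reject (¬? ∘ labelled? x) {(m , x)} {ks} (λ x≢x → x≢x refl)
                                | filter-reject (labelled? l′) {(m , x)} {ks} x≢l′ = filter-labelled-¬labelled ks l′≢l
... | no  x≢l  | yes refl rewrite filter-accept (¬? ∘ labelled? l) {(m , x)} {ks} x≢l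
                                | filter-accept (labelled? x) {(m , x)} {filter (¬? ∘ labelled? l) ks} refl
                                | filter-accept (labelled? x) {(m , x)} {ks} refl =
  cong ((m , x) ∷_) (filter-labelled-¬labelled ks l′≢l)
... | no  x≢l  | no  x≢l′ rewrite filter-accept (¬? ∘ labelled? l) {(m , x)} {ks} x≢l
                                | filter-reject (labelled? l′) {(m , x)} {filter (¬? ∘ labelled? l) ks} x≢l′
                                | filter-reject (labelled? l′) {(m , x)} {ks} x≢l′ = filter-labelled-¬labelled ks l′≢l

concatMap-↭ : ∀ {A B : Set} {f g : A → List B} xs → All (λ x → f x ↭ g x) xs → concatMap f xs ↭ concatMap g xs
concatMap-↭ []       []           = ↭-refl
concatMap-↭ (x ∷ xs) (fx↭ ∷ fxs↭) = Perm.++⁺ fx↭ (concatMap-↭ xs fxs↭)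

↭-concatMap-filter-labelled : ∀ ls (ks : List Key) → Unique ls → All (λ k → proj₂ k ∈ ls) ks →
  ks ↭ concatMap (λ l → filter (labelled? l) ks) ls
↭-concatMap-filter-labelled []       []       _ [] = ↭-refl
↭-concatMap-filter-labelled (l ∷ ls) ks (l∉ls ∷ unique) labels∈ =
  ↭-trans (↭-filter++filter-¬ (labelled? l) ks)
    (Perm.++⁺ˡ (filter (labelled? l) ks)
      (↭-trans (↭-concatMap-filter-labelled ls others unique others∈)
        (↭-reflexive (cong concat (map-cong-local
          (All.tabulate (λ l′∈ → filter-labelled-¬labelled ks (λ l′≡l → All.lookup l∉ls l′∈ (sym l′≡l)))))))))
  where
  others : List Key
  others = filter (¬? ∘ labelled? l) ks
  others∈ : All (λ k → proj₂ k ∈ ls) others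
  others∈ = All.tabulate λ k∈ → let k∈ks , k≢ = ∈-filter⁻ (¬? ∘ labelled? l) k∈ in
    case All.lookup labels∈ k∈ks of λ { (here k≡) → contradiction k≡ k≢ ; (there k∈ls) → k∈ls }

-- The arithmetic behind the Gaussian factor of a block: A = j (a + 2), y = Y_{j-1}, p = λ_j, q = λ_{j+1}.

gauss-top-feasible : ∀ A y p q → q ≤ p → 2 * (y + p) ≤ A → A ∸ 2 * (y + p) + (p ∸ q) ≡ A ∸ y ∸ (y + p + q)
gauss-top-feasible A y p q q≤p 2[y+p]≤A with m≤n⇒∃[o]m+o≡n q≤p | m≤n⇒∃[o]m+o≡n 2[y+p]≤A
... | k , refl | e , refl = begin
  2 * (y + (q + k)) + e ∸ 2 * (y + (q + k)) + (q + k ∸ q) ≡⟨ cong₂ _+_ (m+n∸m≡n (2 * (y + (q + k))) e) (m+n∸m≡n q k) ⟩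
  e + k                                                 ≡⟨ m+n∸m≡n (y + (y + (q + k) + q)) (e + k) ⟨
  y + (y + (q + k) + q) + (e + k) ∸ (y + (y + (q + k) + q)) ≡⟨ cong (_∸ (y + (y + (q + k) + q))) regroup ⟩
  2 * (y + (q + k)) + e ∸ (y + (y + (q + k) + q))        ≡⟨ ∸-+-assoc _ y (y + (q + k) + q) ⟨
  2 * (y + (q + k)) + e ∸ y ∸ (y + (q + k) + q)          ∎
  where
  open ≡-Reasoning
  regroup : y + (y + (q + k) + q) + (e + k) ≡ 2 * (y + (q + k)) + e
  regroup = solve 4 (λ y q k e → y :+ (y :+ (q :+ k) :+ q) :+ (e :+ k) := con 2 :* (y :+ (q :+ k)) :+ e) refl y q k e

gauss-top-infeasible : ∀ A y p q → q < p → A < 2 * (y + p) → A ∸ y ∸ (y + p + q) < p ∸ q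
gauss-top-infeasible A y p q q<p A<2[y+p] with m≤n⇒∃[o]m+o≡n q<p
... | k , refl rewrite sym (+-suc q k) | m+n∸m≡n q (suc k) | ∸-+-assoc A y (y + (q + suc k) + q) =
  m<n+o⇒m∸n<o A (y + (y + (q + suc k) + q)) (subst (A <_) regroup A<2[y+p])
  where
  regroup : 2 * (y + (q + suc k)) ≡ y + (y + (q + suc k) + q) + suc k
  regroup = solve 3 (λ y q k → con 2 :* (y :+ (q :+ (con 1 :+ k)))
                                := y :+ (y :+ (q :+ (con 1 :+ k)) :+ q) :+ (con 1 :+ k)) refl y q k

[m+o]∸n∸o≡m∸n : ∀ m n o → m + o ∸ n ∸ o ≡ m ∸ n
[m+o]∸n∸o≡m∸n m n o =
  trans (∸-+-assoc (m + o) n o) (trans (cong₂ _∸_ (+-comm m o) (+-comm n o)) ([m+n]∸[m+o]≡n∸o o m n))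

coeff-gauss-cong : ∀ {n n′} k → (1 ≤ k → n ≡ n′) → ∀ m → coeff (gauss n k) m ≡ coeff (gauss n′ k) m
coeff-gauss-cong {n} {n′} zero    _    m = trans (coeff-gauss-0 n m) (sym (coeff-gauss-0 n′ m))
coeff-gauss-cong         (suc k) n≡n′ m = cong (λ n → coeff (gauss n (suc k)) m) (n≡n′ (s≤s z≤n))

module Blocks (a : ℕ) {lam : List ℕ} (dec : Nonincreasing lam) where

  blockSize : ℕ → ℕ
  blockSize j = part lam j ∸ part lam (suc j)

  ΣMin ΣMax twiceY gaussTop : ℕ → ℕ
  ΣMin j     = j * (part lam j + part lam (suc j) ∸ 1)
  ΣMax j     = j * (a + 1 + part lam j + part lam (suc j))
  twiceY j   = 2 * Y lam j
  gaussTop j = j * (a + 2) ∸ Y lam (j ∸ 1) ∸ Y lam (suc j)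

  InRange : ℕ → ℕ → Set
  InRange j x = ΣMin j ≤ x × x + twiceY j ≤ ΣMax j

  IsBlock : ℕ → List ℕ → Set
  IsBlock j B = length B ≡ blockSize j × Linked _≤_ B × All (InRange j) B

  Feasible : ℕ → Set
  Feasible j = twiceY j + ΣMin j ≤ ΣMax j

  -- The extra argument k ≡ blockSize j lets proofs split on whether the block is empty.
  blocksIf : ∀ j → Dec (Feasible j) → ℕ → List (List ℕ)
  blocksIf j (yes _) _       = window (blockSize j) (ΣMin j) (ΣMax j ∸ twiceY j ∸ ΣMin j)
  blocksIf j (no  _) zero    = [] ∷ []
  blocksIf j (no  _) (suc _) = []

  feasible? : ∀ j → Dec (Feasible j)
  feasible? j = twiceY j + ΣMin j ≤? ΣMax j

  blocks : ℕ → List (List ℕ)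
  blocks j = blocksIf j (feasible? j) (blockSize j)

  ΣMax≡ : ∀ j → 1 ≤ blockSize j → ΣMax j ≡ j * (a + 2) + ΣMin j
  ΣMax≡ j 1≤k = begin
    j * (a + 1 + p + q)       ≡⟨ cong (j *_) (trans (+-assoc (a + 1) p q) (cong (a + 1 +_) (sym (m+[n∸m]≡n 1≤p+q)))) ⟩
    j * (a + 1 + (1 + (p + q ∸ 1)))
      ≡⟨ cong (j *_) (solve 2 (λ a t → a :+ con 1 :+ (con 1 :+ t) := a :+ con 2 :+ t) refl a (p + q ∸ 1)) ⟩
    j * (a + 2 + (p + q ∸ 1)) ≡⟨ *-distribˡ-+ j (a + 2) (p + q ∸ 1) ⟩
    j * (a + 2) + ΣMin j      ∎
    where
    open ≡-Reasoning
    p q : ℕ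
    p = part lam j
    q = part lam (suc j)
    1≤p+q : 1 ≤ p + q
    1≤p+q = ≤-trans (≤-trans 1≤k (m∸n≤m p q)) (m≤m+n p q)

  twiceY≡ : ∀ i → twiceY (suc i) ≡ 2 * (Y lam i + part lam (suc i))
  twiceY≡ i = cong (2 *_) (Y-suc lam i)

  Y-suc-suc : ∀ i → Y lam (suc (suc i)) ≡ Y lam i + part lam (suc i) + part lam (suc (suc i))
  Y-suc-suc i = trans (Y-suc lam (suc i)) (cong (_+ part lam (suc (suc i))) (Y-suc lam i))

  feasible⇒ : ∀ j → 1 ≤ blockSize j → Feasible j → twiceY j ≤ j * (a + 2)
  feasible⇒ j 1≤k feasible = +-cancelʳ-≤ (ΣMin j) _ _ (subst (twiceY j + ΣMin j ≤_) (ΣMax≡ j 1≤k) feasible)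

  infeasible⇒ : ∀ j → 1 ≤ blockSize j → ¬ Feasible j → j * (a + 2) < twiceY j
  infeasible⇒ j 1≤k infeasible = ≰⇒> λ 2Y≤A →
    infeasible (subst (twiceY j + ΣMin j ≤_) (sym (ΣMax≡ j 1≤k)) (+-monoˡ-≤ (ΣMin j) 2Y≤A))

  gaussTop-feasible : ∀ j → 1 ≤ j → Feasible j → 1 ≤ blockSize j →
    ΣMax j ∸ twiceY j ∸ ΣMin j + blockSize j ≡ gaussTop j
  gaussTop-feasible (suc i) _ feasible 1≤k = begin
    ΣMax j ∸ twiceY j ∸ ΣMin j + blockSize j
      ≡⟨ cong (λ m → m ∸ twiceY j ∸ ΣMin j + blockSize j) (ΣMax≡ j 1≤k) ⟩
    j * (a + 2) + ΣMin j ∸ twiceY j ∸ ΣMin j + blockSize j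
      ≡⟨ cong (_+ blockSize j) (trans ([m+o]∸n∸o≡m∸n (j * (a + 2)) (twiceY j) (ΣMin j))
                                     (cong (j * (a + 2) ∸_) (twiceY≡ i))) ⟩
    j * (a + 2) ∸ 2 * (Y lam i + part lam j) + blockSize j
      ≡⟨ gauss-top-feasible _ (Y lam i) (part lam j) _ (part-suc≤part dec j (s≤s z≤n))
                            (subst (_≤ j * (a + 2)) (twiceY≡ i) (feasible⇒ j 1≤k feasible)) ⟩
    j * (a + 2) ∸ Y lam i ∸ (Y lam i + part lam j + part lam (suc j))
      ≡⟨ cong (j * (a + 2) ∸ Y lam i ∸_) (Y-suc-suc i) ⟨
    gaussTop j ∎
    where
    open ≡-Reasoning
    j : ℕ
    j = suc i

  gaussTop-infeasible : ∀ j → 1 ≤ j → ¬ Feasible j → 1 ≤ blockSize j → gaussTop j < blockSize j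
  gaussTop-infeasible (suc i) _ infeasible 1≤k =
    subst (λ Y′ → j * (a + 2) ∸ Y lam i ∸ Y′ < blockSize j) (sym (Y-suc-suc i))
      (gauss-top-infeasible _ (Y lam i) (part lam j) _ q<p
        (subst (j * (a + 2) <_) (twiceY≡ i) (infeasible⇒ j 1≤k infeasible)))
    where
    j : ℕ
    j = suc i
    q<p : part lam (suc j) < part lam j
    q<p = ≤-trans (+-monoˡ-≤ (part lam (suc j)) 1≤k) (≤-reflexive (m∸n+n≡m (part-suc≤part dec j (s≤s z≤n))))

  window⇔range : ∀ j → Feasible j → ∀ x →
    (ΣMin j ≤ x × x ≤ ΣMin j + (ΣMax j ∸ twiceY j ∸ ΣMin j)) ⇔ InRange j x
  window⇔range j feasible x = mk⇔ (λ (L≤x , x≤) → L≤x , m≤o∸n⇒m+n≤o x 2Y≤R (subst (x ≤_) L+w≡ x≤))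
                                   (λ (L≤x , x+2Y≤R) → L≤x , subst (x ≤_) (sym L+w≡) (m+n≤o⇒m≤o∸n x x+2Y≤R))
    where
    2Y≤R : twiceY j ≤ ΣMax j
    2Y≤R = m+n≤o⇒m≤o (twiceY j) feasible
    L+w≡ : ΣMin j + (ΣMax j ∸ twiceY j ∸ ΣMin j) ≡ ΣMax j ∸ twiceY j
    L+w≡ = m+[n∸m]≡n (m+n≤o⇒m≤o∸n (ΣMin j) (subst (_≤ ΣMax j) (+-comm (twiceY j) (ΣMin j)) feasible))

  blocksIf-sound : ∀ j d k → k ≡ blockSize j → ∀ {B} → B ∈ blocksIf j d k → IsBlock j B
  blocksIf-sound j (yes feasible) k _ B∈ with window-sound (blockSize j) (ΣMin j) (ΣMax j ∸ twiceY j ∸ ΣMin j) B∈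
  ... | length≡ , asc , bnd = length≡ , asc , All.map (Equivalence.to (window⇔range j feasible _)) bnd
  blocksIf-sound j (no _) zero 0≡k (here refl) = 0≡k , [] , []

  blocksIf-complete : ∀ j d k → k ≡ blockSize j → ∀ {B} → IsBlock j B → B ∈ blocksIf j d k
  blocksIf-complete j (yes feasible) k _ (length≡ , asc , bnd) =
    window-complete (blockSize j) (ΣMin j) (ΣMax j ∸ twiceY j ∸ ΣMin j)
      (length≡ , asc , All.map (Equivalence.from (window⇔range j feasible _)) bnd)
  blocksIf-complete j (no _) zero    _   {[]}    _               = here refl
  blocksIf-complete j (no _) (suc k) 1+k≡ {[]}    (0≡k , _)       = contradiction (trans 0≡k (sym 1+k≡)) (λ ())
  blocksIf-complete j (no infeasible) k _ {x ∷ B} (_ , _ , (L≤x , x+2Y≤R) ∷ _) =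
    contradiction (≤-trans (+-monoʳ-≤ (twiceY j) L≤x) (subst (_≤ ΣMax j) (+-comm x (twiceY j)) x+2Y≤R)) infeasible

  blocksIf-unique : ∀ j d k → Unique (blocksIf j d k)
  blocksIf-unique j (yes _) k       = window-unique (blockSize j) (ΣMin j) (ΣMax j ∸ twiceY j ∸ ΣMin j)
  blocksIf-unique j (no _)  zero    = [] ∷ []
  blocksIf-unique j (no _)  (suc k) = []

  occurrences-sum-blocksIf : ∀ j → 1 ≤ j → ∀ d k → k ≡ blockSize j → ∀ n →
    occurrences (map sum (blocksIf j d k)) n ≡ shifted (k * ΣMin j) (coeff (gauss (gaussTop j) k)) n
  occurrences-sum-blocksIf j 1≤j (yes feasible) k refl n =
    trans (occurrences-sum-window k (ΣMin j) _ n)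
          (shifted-cong (k * ΣMin j) (coeff-gauss-cong k (gaussTop-feasible j 1≤j feasible)) n)
  occurrences-sum-blocksIf j 1≤j (no _) zero _ n = trans (+-identityʳ _) (sym (coeff-gauss-0 (gaussTop j) n))
  occurrences-sum-blocksIf j 1≤j (no infeasible) (suc k) 1+k≡ n =
    sym (shifted-zero (suc k * ΣMin j) _ (coeff-gauss-> (gaussTop j) (suc k)
          (subst (gaussTop j <_) (sym 1+k≡) (gaussTop-infeasible j 1≤j infeasible (subst (1 ≤_) 1+k≡ (s≤s z≤n))))) n)

module Tuples (a b : ℕ) {lam : List ℕ} (dec : Nonincreasing lam) (short : length lam ≤ b) where

  open Blocks a dec public

  BlockCondition : ℕ → List ℕ → ℕ → Set
  BlockCondition j σ i = InRange j (σ ! i) × (suc i ≤ part lam j → σ ! i ≤ σ ! suc i)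

  -- σ = (Σ_1, …, Σ_{λ_j}) satisfies the conditions of the blocks j, j + 1, ….
  AdmissibleFrom : ℕ → List ℕ → Set
  AdmissibleFrom j σ = length σ ≡ part lam j
    × (∀ j′ → j ≤ j′ → ∀ i → part lam (suc j′) < i → i ≤ part lam j′ → BlockCondition j′ σ i)

  tuples : ℕ → ℕ → List (List ℕ)
  tuples j zero    = [] ∷ []
  tuples j (suc m) = appendProduct (blocks j) (tuples (suc j) m)

  part-beyond-b : ∀ {j} → b < j → part lam j ≡ 0
  part-beyond-b b<j = part-beyond lam _ (≤-<-trans short b<j)

  blockCondition-transfer : ∀ {j} σ τ {i} → (∀ i′ → 1 ≤ i′ → i′ ≤ part lam j → σ ! i′ ≡ τ ! i′) →
    1 ≤ i → i ≤ part lam j → BlockCondition j τ i → BlockCondition j σ i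
  blockCondition-transfer σ τ {i} σ≡τ 1≤i i≤p (range , step) rewrite σ≡τ i 1≤i i≤p =
    range , λ i<p → subst (_ ≤_) (sym (σ≡τ (suc i) (s≤s z≤n) i<p)) (step i<p)

  block-index : ∀ j → 1 ≤ j → ∀ {t} → suc (part lam (suc j) + t) ≤ part lam j → t < blockSize j
  block-index j 1≤j {t} i≤p = m+n≤o⇒m≤o∸n (suc t) (subst (_≤ part lam j) (cong suc (+-comm (part lam (suc j)) t)) i≤p)

  admissible-++ : ∀ j → 1 ≤ j → ∀ {τ B} → AdmissibleFrom (suc j) τ → IsBlock j B → AdmissibleFrom j (τ ++ B)
  admissible-++ j 1≤j {τ} {B} (length-τ , conditions-τ) (length-B , asc-B , range-B) = length-τ++B , conditions
    where
    q : ℕ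
    q = part lam (suc j)
    length-τ++B : length (τ ++ B) ≡ part lam j
    length-τ++B = trans (length-++ τ) (trans (cong₂ _+_ length-τ length-B) (m+[n∸m]≡n (part-suc≤part dec j 1≤j)))
    at-B : ∀ t → at (τ ++ B) (q + t) ≡ at B t
    at-B t = subst (λ n → at (τ ++ B) (n + t) ≡ at B t) length-τ (at-++ʳ τ B t)
    conditions : ∀ j′ → j ≤ j′ → ∀ i → part lam (suc j′) < i → i ≤ part lam j′ → BlockCondition j′ (τ ++ B) i
    conditions j′ j≤j′ i q′<i i≤p′ with j′ ≟ j
    ... | no j′≢j = blockCondition-transfer (τ ++ B) τ τ-prefix (≤-trans (s≤s z≤n) q′<i) i≤p′
                      (conditions-τ j′ j<j′ i q′<i i≤p′)
      where
      j<j′ : j < j′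
      j<j′ = ≤∧≢⇒< j≤j′ (j′≢j ∘ sym)
      τ-prefix : ∀ i′ → 1 ≤ i′ → i′ ≤ part lam j′ → (τ ++ B) ! i′ ≡ τ ! i′
      τ-prefix (suc i′) _ i′<p′ =
        at-++ˡ τ B i′ (subst (suc i′ ≤_) (sym length-τ) (≤-trans i′<p′ (part-antitone dec (s≤s z≤n) j<j′)))
    ... | yes refl with m≤n⇒∃[o]m+o≡n q′<i
    ... | t , refl = subst (InRange j) (sym (at-B t)) (All-at⁻ B range-B t t<k)
                   , λ i<p → subst₂ _≤_ (sym (at-B t)) (trans (sym (at-B (suc t))) (cong (at (τ ++ B)) (+-suc q t)))
                               (Linked-at⁻ B asc-B t (subst (suc t <_) (sym length-B)
                                 (block-index j 1≤j (subst (_≤ part lam j) (cong suc (sym (+-suc q t))) i<p))))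
      where
      t<k : t < length B
      t<k = subst (t <_) (sym length-B) (block-index j 1≤j i≤p′)

  admissible-take : ∀ j → 1 ≤ j → ∀ {σ} → AdmissibleFrom j σ → AdmissibleFrom (suc j) (take (part lam (suc j)) σ)
  admissible-take j 1≤j {σ} (length-σ , conditions) = length-τ , λ j′ j<j′ i q′<i i≤p′ →
    blockCondition-transfer (take q σ) σ (prefix j′ j<j′) (≤-trans (s≤s z≤n) q′<i) i≤p′
      (conditions j′ (<⇒≤ j<j′) i q′<i i≤p′)
    where
    q : ℕ
    q = part lam (suc j)
    length-τ : length (take q σ) ≡ q
    length-τ = trans (length-take q σ) (m≤n⇒m⊓n≡m (subst (q ≤_) (sym length-σ) (part-suc≤part dec j 1≤j)))
    prefix : ∀ j′ → suc j ≤ j′ → ∀ i′ → 1 ≤ i′ → i′ ≤ part lam j′ → take q σ ! i′ ≡ σ ! i′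
    prefix j′ j<j′ (suc i′) _ i′<p′ = at-take σ q i′ (≤-trans i′<p′ (part-antitone dec (s≤s z≤n) j<j′))

  admissible-drop : ∀ j → 1 ≤ j → ∀ {σ} → AdmissibleFrom j σ → IsBlock j (drop (part lam (suc j)) σ)
  admissible-drop j 1≤j {σ} (length-σ , conditions) =
      length-B
    , Linked-at⁺ B ascending-B
    , All-at⁺ B (λ t t<k → subst (InRange j) (sym (at-drop σ q t)) (proj₁ (condition t t<k)))
    where
    q : ℕ
    q = part lam (suc j)
    B : List ℕ
    B = drop q σ
    length-B : length B ≡ blockSize j
    length-B = trans (length-drop q σ) (cong (_∸ q) length-σ)
    in-block : ∀ t → t < length B → suc (q + t) ≤ part lam j
    in-block t t<k = subst (_≤ part lam j) (cong suc (+-comm t q))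
                       (m≤o∸n⇒m+n≤o (suc t) (part-suc≤part dec j 1≤j) (subst (suc t ≤_) length-B t<k))
    condition : ∀ t → t < length B → BlockCondition j σ (suc (q + t))
    condition t t<k = conditions j ≤-refl (suc (q + t)) (s≤s (m≤m+n q t)) (in-block t t<k)
    ascending-B : ∀ t → suc t < length B → at B t ≤ at B (suc t)
    ascending-B t t<k =
      subst₂ _≤_ (sym (at-drop σ q t)) (trans (cong (at σ) (sym (+-suc q t))) (sym (at-drop σ q (suc t))))
      (proj₂ (condition t (<⇒≤ t<k)) (subst (_≤ part lam j) (cong suc (+-suc q t)) (in-block (suc t) t<k)))

  admissible-[] : ∀ j → b < j → AdmissibleFrom j []
  admissible-[] j b<j = sym (part-beyond-b b<j) , λ j′ j≤j′ i q′<i i≤p′ →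
    contradiction (subst (i ≤_) (part-beyond-b (<-≤-trans b<j j≤j′)) i≤p′) (<⇒≱ (≤-trans (s≤s z≤n) q′<i))

  tuples-sound : ∀ m j → 1 ≤ j → j + m ≡ suc b → ∀ {σ} → σ ∈ tuples j m → AdmissibleFrom j σ
  tuples-sound zero    j _   j≡ (here refl) = admissible-[] j (≤-reflexive (sym (trans (sym (+-identityʳ j)) j≡)))
  tuples-sound (suc m) j 1≤j j≡ σ∈ with ∈-cartesianProductWith⁻ (λ xs ys → ys ++ xs) (blocks j) (tuples (suc j) m) σ∈
  ... | B , τ , B∈ , τ∈ , refl =
    admissible-++ j 1≤j {τ} {B} (tuples-sound m (suc j) (s≤s z≤n) (trans (sym (+-suc j m)) j≡) τ∈)
                        (blocksIf-sound j (feasible? j) (blockSize j) refl B∈)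

  tuples-complete : ∀ m j → 1 ≤ j → j + m ≡ suc b → ∀ {σ} → AdmissibleFrom j σ → σ ∈ tuples j m
  tuples-complete zero    j _   j≡ {σ} (length-σ , _) =
    here (length≡0⇒[] (trans length-σ (part-beyond-b (≤-reflexive (sym (trans (sym (+-identityʳ j)) j≡))))))
    where
    length≡0⇒[] : ∀ {xs : List ℕ} → length xs ≡ 0 → xs ≡ []
    length≡0⇒[] {[]} _ = refl
  tuples-complete (suc m) j 1≤j j≡ {σ} admissible =
    subst (_∈ tuples j (suc m)) (take++drop≡id (part lam (suc j)) σ)
      (∈-cartesianProductWith⁺ (λ xs ys → ys ++ xs)
         (blocksIf-complete j (feasible? j) (blockSize j) refl (admissible-drop j 1≤j {σ} admissible))
         (tuples-complete m (suc j) (s≤s z≤n) (trans (sym (+-suc j m)) j≡) (admissible-take j 1≤j {σ} admissible)))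

  tuples-unique : ∀ m j → 1 ≤ j → j + m ≡ suc b → Unique (tuples j m)
  tuples-unique zero    j _   _  = [] ∷ []
  tuples-unique (suc m) j 1≤j j≡ =
    appendProduct-unique (part lam (suc j)) (blocks j) (tuples (suc j) m)
      (blocksIf-unique j (feasible? j) (blockSize j)) (tuples-unique m (suc j) (s≤s z≤n) j≡′)
      (All.tabulate (λ σ∈ → proj₁ (tuples-sound m (suc j) (s≤s z≤n) j≡′ σ∈)))
    where
    j≡′ : suc j + m ≡ suc b
    j≡′ = trans (sym (+-suc j m)) j≡

  gaussFactor : ℕ → Poly
  gaussFactor j = gauss (gaussTop j) (blockSize j)

  gaussProduct : ℕ → ℕ → Poly
  gaussProduct j zero    = one
  gaussProduct j (suc m) = gaussFactor j ⊛ gaussProduct (suc j) m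

  occurrences-sum-tuples : ∀ m j → 1 ≤ j → ∀ n →
    occurrences (map sum (tuples j m)) n ≡ shifted (sumFrom (blockShift lam) j m) (coeff (gaussProduct j m)) n
  occurrences-sum-tuples zero    j _   n = trans (+-identityʳ (monomial 0 n)) (sym (coeff-one n))
  occurrences-sum-tuples (suc m) j 1≤j n = begin
    occurrences (map sum (appendProduct (blocks j) (tuples (suc j) m))) n
      ≡⟨ occurrences-sum-appendProduct (blocks j) (tuples (suc j) m) n ⟩
    convolve (occurrences (map sum (blocks j))) (occurrences (map sum (tuples (suc j) m))) n
      ≡⟨ convolve-congˡ _ (occurrences-sum-blocksIf j 1≤j (feasible? j) (blockSize j) refl) n ⟩
    convolve (shifted d (coeff (gaussFactor j))) (occurrences (map sum (tuples (suc j) m))) n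
      ≡⟨ convolve-congʳ _ (occurrences-sum-tuples m (suc j) (s≤s z≤n)) n ⟩
    convolve (shifted d (coeff (gaussFactor j))) (shifted e (coeff (gaussProduct (suc j) m))) n
      ≡⟨ convolve-shiftedˡ d (coeff (gaussFactor j)) (shifted e (coeff (gaussProduct (suc j) m))) n ⟩
    shifted d (convolve (coeff (gaussFactor j)) (shifted e (coeff (gaussProduct (suc j) m)))) n
      ≡⟨ shifted-cong d (convolve-shiftedʳ e (coeff (gaussFactor j)) (coeff (gaussProduct (suc j) m))) n ⟩
    shifted d (shifted e (convolve (coeff (gaussFactor j)) (coeff (gaussProduct (suc j) m)))) n
      ≡⟨ shifted-shifted d e _ n ⟩
    shifted (d + e) (convolve (coeff (gaussFactor j)) (coeff (gaussProduct (suc j) m))) n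
      ≡⟨ shifted-cong (d + e) (λ k → sym (coeff-⊛ (gaussFactor j) (gaussProduct (suc j) m) k)) n ⟩
    shifted (d + e) (coeff (gaussProduct j (suc m))) n ∎
    where
    open ≡-Reasoning
    d e : ℕ
    d = blockShift lam j
    e = sumFrom (blockShift lam) (suc j) m

  sumFrom-blockShift-total : sumFrom (blockShift lam) 1 b ≡ 2 * sum (map (_C 2) lam)
  sumFrom-blockShift-total = begin
    sumFrom (blockShift lam) 1 b
      ≡⟨ +-identityʳ _ ⟨
    sumFrom (blockShift lam) 1 b + 0
      ≡⟨ cong (sumFrom (blockShift lam) 1 b +_)
              (trans (cong (λ x → b * falling2 x) (part-beyond-b ≤-refl)) (*-zeroʳ b)) ⟨
    sumFrom (blockShift lam) 1 b + b * falling2 (part lam (suc b))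
      ≡⟨ sumFrom-blockShift dec 0 b ⟩
    sumFrom (falling2-parts lam) 1 b
      ≡⟨ sumFrom-falling2-parts lam b short ⟩
    sum (map falling2 lam)
      ≡⟨ sum-map-cong (All.universal falling2≡2*C2 lam) ⟩
    sum (map (λ x → 2 * (x C 2)) lam)
      ≡⟨ sum-map-*ˡ 2 (_C 2) lam ⟩
    2 * sum (map (_C 2) lam) ∎
    where
    open ≡-Reasoning
    sum-map-*ˡ : ∀ c (f : ℕ → ℕ) xs → sum (map (λ x → c * f x) xs) ≡ c * sum (map f xs)
    sum-map-*ˡ c f []       = sym (*-zeroʳ c)
    sum-map-*ˡ c f (x ∷ xs) = trans (cong (c * f x +_) (sum-map-*ˡ c f xs)) (sym (*-distribˡ-+ c (f x) _))

  gaussProduct≡prodP : ∀ m j → gaussProduct j m ≡ prodP (applyUpTo (λ i → gaussFactor (j + i)) m)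
  gaussProduct≡prodP zero    j = refl
  gaussProduct≡prodP (suc m) j = cong₂ _⊛_ (cong gaussFactor (sym (+-identityʳ j)))
    (trans (gaussProduct≡prodP m (suc j)) (cong prodP (applyUpTo-cong (λ i → cong gaussFactor (sym (+-suc j i))) m)))
    where
    applyUpTo-cong : ∀ {A : Set} {f g : ℕ → A} → (∀ i → f i ≡ g i) → ∀ m → applyUpTo f m ≡ applyUpTo g m
    applyUpTo-cong f≗g zero    = refl
    applyUpTo-cong f≗g (suc m) = cong₂ _∷_ (f≗g 0) (applyUpTo-cong (f≗g ∘ suc) m)

  coeff-F : ∀ n → coeff (F a b lam) n ≡ occurrences (map sum (tuples 1 b)) n
  coeff-F n = begin
    coeff (F a b lam) n
      ≡⟨ coeff-shift (2 * sum (map (_C 2) lam)) (prodP (applyUpTo (λ i → gaussFactor (suc i)) b)) n ⟩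
    shifted (2 * sum (map (_C 2) lam)) (coeff (prodP (applyUpTo (λ i → gaussFactor (suc i)) b))) n
      ≡⟨ cong (λ d → shifted d (coeff (prodP (applyUpTo (λ i → gaussFactor (suc i)) b))) n) sumFrom-blockShift-total ⟨
    shifted (sumFrom (blockShift lam) 1 b) (coeff (prodP (applyUpTo (λ i → gaussFactor (suc i)) b))) n
      ≡⟨ shifted-cong (sumFrom (blockShift lam) 1 b) (λ k → cong (λ P → coeff P k) (gaussProduct≡prodP b 1)) n ⟨
    shifted (sumFrom (blockShift lam) 1 b) (coeff (gaussProduct 1 b)) n
      ≡⟨ occurrences-sum-tuples b 1 (s≤s z≤n) n ⟨
    occurrences (map sum (tuples 1 b)) n ∎
    where open ≡-Reasoning

-- Modular diagrams as sorted lists of keys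

module Rows {N : ℕ} (1≤N : 1 ≤ N) where

  row : Key → List ℕ
  row (m , l) = replicate m N ++ l ∷ []

  key : List ℕ → Key
  key r = len r , label r

  length-row : ∀ k → length (row k) ≡ suc (proj₁ k)
  length-row (m , l) = trans (length-++ (replicate m N)) (trans (cong (_+ 1) (length-replicate m)) (+-comm m 1))

  len-row : ∀ k → len (row k) ≡ proj₁ k
  len-row k = cong (_∸ 1) (length-row k)

  label-row : ∀ k → label (row k) ≡ proj₂ k
  label-row (m , l) = lastOr-replicate 0 m
    where
    lastOr-replicate : ∀ d m → lastOr d (replicate m N ++ l ∷ []) ≡ l
    lastOr-replicate d zero    = refl
    lastOr-replicate d (suc m) = lastOr-replicate N m

  at-row-< : ∀ m l c → c < m → at (row (m , l)) c ≡ N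
  at-row-< (suc m) l zero    _         = refl
  at-row-< (suc m) l (suc c) (s≤s c<m) = at-row-< m l c c<m

  at-row-len : ∀ m l → at (row (m , l)) m ≡ l
  at-row-len zero    l = refl
  at-row-len (suc m) l = at-row-len m l

  row-cells : ∀ m l → 1 ≤ l → l ≤ N → All (λ x → 1 ≤ x × x ≤ N) (row (m , l))
  row-cells m l 1≤l l≤N = All.++⁺ (All.replicate⁺ m (1≤N , ≤-refl)) ((1≤l , l≤N) ∷ [])

  NonLastCells : List ℕ → Set
  NonLastCells r = ∀ c → suc c < length r → at r c ≡ N

  row-key : ∀ r → 1 ≤ length r → NonLastCells r → row (key r) ≡ r
  row-key (x ∷ [])     _ _       = refl
  row-key (x ∷ y ∷ r) _ nonLast =
    cong₂ _∷_ (sym (nonLast 0 (s≤s (s≤s z≤n)))) (row-key (y ∷ r) (s≤s z≤n) (λ c c<n → nonLast (suc c) (s≤s c<n)))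

  All-nonLastCells⁺ : ∀ (D : Diagram) → (∀ i c → suc c < length (rowAt D i) → cell D i c ≡ N) → All NonLastCells D
  All-nonLastCells⁺ []      nonLast = []
  All-nonLastCells⁺ (r ∷ D) nonLast = nonLast 0 ∷ All-nonLastCells⁺ D (nonLast ∘ suc)

  All-nonLastCells⁻ : ∀ (D : Diagram) → All NonLastCells D → ∀ i c → suc c < length (rowAt D i) → cell D i c ≡ N
  All-nonLastCells⁻ (r ∷ D) (nonLast ∷ _) zero    = nonLast
  All-nonLastCells⁻ (r ∷ D) (_ ∷ nonLast) (suc i) = All-nonLastCells⁻ D nonLast i

  at-len≡label : ∀ r → 1 ≤ length r → at r (len r) ≡ label r
  at-len≡label (x ∷ [])     _ = refl
  at-len≡label (x ∷ y ∷ r) _ = at-len≡label (y ∷ r) (s≤s z≤n)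

  label∈ : ∀ r → 1 ≤ length r → label r ∈ r
  label∈ (x ∷ [])     _ = here refl
  label∈ (x ∷ y ∷ r) _ = there (label∈ (y ∷ r) (s≤s z≤n))

  keys-sorted : ∀ (D : Diagram) → All (λ r → 1 ≤ length r) D → (∀ i → len (rowAt D (suc i)) ≤ len (rowAt D i)) →
    (∀ i j c → i < j → c < length (rowAt D j) → cell D j c ≤ cell D i c) → Linked _⊑_ (map key D)
  keys-sorted []          _                  _       _      = []
  keys-sorted (r ∷ [])    _                  _       _      = [-]
  keys-sorted (r ∷ s ∷ D) (1≤∣r∣ ∷ 1≤∣s∣ ∷ ne) shorter column =
    r⊑s ∷ keys-sorted (s ∷ D) (1≤∣s∣ ∷ ne) (shorter ∘ suc) (λ i j c i<j → column (suc i) (suc j) c (s≤s i<j))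
    where
    r⊑s : key r ⊑ key s
    r⊑s with len s <? len r
    ... | yes s<r = inj₁ s<r
    ... | no  s≮r = inj₂ (same , subst₂ _≤_ (at-len≡label s 1≤∣s∣)
                                           (trans (cong (at r) (sym same)) (at-len≡label r 1≤∣r∣))
                                         (column 0 1 (len s) (s≤s z≤n) (len<length s 1≤∣s∣)))
      where
      same : len r ≡ len s
      same = ≤-antisym (≮⇒≥ s≮r) (shorter 0)
      len<length : ∀ r → 1 ≤ length r → len r < length r
      len<length (x ∷ r) _ = ≤-refl

  rowAt-rows : ∀ K i → rowAt (map row K) i ≡ [] ⊎ Σ Key λ k → k ∈ K × rowAt (map row K) i ≡ row k
  rowAt-rows []      i       = inj₁ refl
  rowAt-rows (k ∷ K) zero    = inj₂ (k , here refl , refl)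
  rowAt-rows (k ∷ K) (suc i) with rowAt-rows K i
  ... | inj₁ empty          = inj₁ empty
  ... | inj₂ (k′ , k′∈ , eq) = inj₂ (k′ , there k′∈ , eq)

  row-column : ∀ k k′ c → k ⊑ k′ → proj₂ k′ ≤ N → c < length (row k′) → at (row k′) c ≤ at (row k) c
  row-column (m , l) (m′ , l′) c k⊑k′ l′≤N c<∣r′∣ with c <? m′
  ... | yes c<m′ = ≤-reflexive (trans (at-row-< m′ l′ c c<m′) (sym (at-row-< m l c (<-≤-trans c<m′ (m′≤m k⊑k′)))))
    where
    m′≤m : (m , l) ⊑ (m′ , l′) → m′ ≤ m
    m′≤m (inj₁ m′<m)       = <⇒≤ m′<m
    m′≤m (inj₂ (refl , _)) = ≤-refl
  ... | no  c≮m′ with ≤-antisym (≤-pred (subst (c <_) (length-row (m′ , l′)) c<∣r′∣)) (≮⇒≥ c≮m′)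
  ... | refl rewrite at-row-len m′ l′ with k⊑k′
  ... | inj₁ m′<m rewrite at-row-< m l m′ m′<m = l′≤N
  ... | inj₂ (refl , l′≤l) rewrite at-row-len m l = l′≤l

  rows-column : ∀ K → AllPairs _⊑_ K → All (λ k → proj₂ k ≤ N) K →
    ∀ i j c → i < j → c < length (rowAt (map row K) j) → cell (map row K) j c ≤ cell (map row K) i c
  rows-column (k ∷ K) (k⊑ ∷ _) (_ ∷ ≤N) zero (suc j) c _ c< with rowAt-rows K j
  ... | inj₁ empty rewrite empty = contradiction c< (λ ())
  ... | inj₂ (k′ , k′∈ , eq) rewrite eq = row-column k k′ c (All.lookup k⊑ k′∈) (All.lookup ≤N k′∈) c<
  rows-column (k ∷ K) (_ ∷ sorted) (_ ∷ ≤N) (suc i) (suc j) c (s≤s i<j) c< = rows-column K sorted ≤N i j c i<j c<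

  rows-shorter : ∀ K → Linked _⊑_ K → ∀ i → len (rowAt (map row K) (suc i)) ≤ len (rowAt (map row K) i)
  rows-shorter []           _            i       = z≤n
  rows-shorter (k ∷ [])     _            zero    = z≤n
  rows-shorter (k ∷ [])     _            (suc i) = z≤n
  rows-shorter (k ∷ k′ ∷ K) (k⊑k′ ∷ _)   zero    rewrite len-row k | len-row k′ = m′≤m k⊑k′
    where
    m′≤m : k ⊑ k′ → proj₁ k′ ≤ proj₁ k
    m′≤m (inj₁ m′<m)     = <⇒≤ m′<m
    m′≤m (inj₂ (m≡m′ , _)) = ≤-reflexive (sym m≡m′)
  rows-shorter (k ∷ k′ ∷ K) (_ ∷ sorted) (suc i) = rows-shorter (k′ ∷ K) sorted i

  LabelInRange : Key → Set
  LabelInRange k = 1 ≤ proj₂ k × proj₂ k ≤ N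

  rows-modular : ∀ K → Linked _⊑_ K → All LabelInRange K → IsModular N (length K) (map row K)
  rows-modular K sorted labels =
      length-map row K
    , All.map⁺ (All.universal (λ k → subst (1 ≤_) (sym (length-row k)) (s≤s z≤n)) K)
    , rows-shorter K sorted
    , All.map⁺ (All.map (λ { {m , l} (1≤l , l≤N) → row-cells m l 1≤l l≤N }) labels)
    , All-nonLastCells⁻ (map row K) (All.map⁺ (All.universal nonLast K))
    , rows-column K (Linked.Linked⇒AllPairs ⊑-trans sorted) (All.map proj₂ labels)
    where
    nonLast : ∀ k → NonLastCells (row k)
    nonLast (m , l) c c<∣r∣ = at-row-< m l c (≤-pred (subst (suc c <_) (length-row (m , l)) c<∣r∣))

  rowsLabeled-rows : ∀ K i → rowsLabeled i (map row K) ≡ map row (filter (labelled? i) K)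
  rowsLabeled-rows []      i = refl
  rowsLabeled-rows (k ∷ K) i = by-label (proj₂ k ≟ i)
    where
    by-label : Dec (proj₂ k ≡ i) → rowsLabeled i (map row (k ∷ K)) ≡ map row (filter (labelled? i) (k ∷ K))
    by-label (yes l≡i) = trans (filter-accept (λ r → label r ≟ i) {row k} {map row K} (trans (label-row k) l≡i))
      (trans (cong (row k ∷_) (rowsLabeled-rows K i)) (cong (map row) (sym (filter-accept (labelled? i) {k} {K} l≡i))))
    by-label (no  l≢i) = trans (filter-reject (λ r → label r ≟ i) {row k} {map row K} (l≢i ∘ trans (sym (label-row k))))
      (trans (rowsLabeled-rows K i) (cong (map row) (sym (filter-reject (labelled? i) {k} {K} l≢i))))

  map-len-rows : ∀ K → map len (map row K) ≡ map proj₁ K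
  map-len-rows K = trans (sym (map-∘ K)) (map-cong-local (All.universal len-row K))

  size-rows : ∀ K → size (map row K) ≡ sum (map proj₁ K)
  size-rows K = cong sum (map-len-rows K)

  Sig-rows : ∀ K i → Sig (map row K) i ≡ sum (map proj₁ (filter (labelled? i) K))
  Sig-rows K i = trans (cong (sum ∘ map len) (rowsLabeled-rows K i)) (size-rows (filter (labelled? i) K))

  filter-labelled-keys : ∀ (D : Diagram) l → filter (labelled? l) (map key D) ≡ map (_, l) (map len (rowsLabeled l D))
  filter-labelled-keys []      l = refl
  filter-labelled-keys (r ∷ D) l = by-label (label r ≟ l)
    where
    by-label : Dec (label r ≡ l) → filter (labelled? l) (map key (r ∷ D)) ≡ map (_, l) (map len (rowsLabeled l (r ∷ D)))
    by-label (yes refl) = trans (filter-accept (labelled? l) {key r} {map key D} refl)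
      (trans (cong (key r ∷_) (filter-labelled-keys D l))
             (cong (map (_, l) ∘ map len) (sym (filter-accept (λ r → label r ≟ l) {r} {D} refl))))
    by-label (no  ≢l)   = trans (filter-reject (labelled? l) {key r} {map key D} ≢l)
      (trans (filter-labelled-keys D l)
             (cong (map (_, l) ∘ map len) (sym (filter-reject (λ r → label r ≟ l) {r} {D} ≢l))))

monomial-refl : ∀ n → monomial n n ≡ 1
monomial-refl zero    = refl
monomial-refl (suc n) = monomial-refl n

monomial-≢ : ∀ {x n} → x ≢ n → monomial x n ≡ 0
monomial-≢ {zero}  {zero}  x≢n = contradiction refl x≢n
monomial-≢ {zero}  {suc n} x≢n = refl
monomial-≢ {suc x} {zero}  x≢n = refl
monomial-≢ {suc x} {suc n} x≢n = monomial-≢ (x≢n ∘ cong suc)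

length-filter-≟ : ∀ {A : Set} (f : A → ℕ) xs n → length (filter (λ x → f x ≟ n) xs) ≡ occurrences (map f xs) n
length-filter-≟ f []       n = refl
length-filter-≟ f (x ∷ xs) n = by (f x ≟ n)
  where
  by : Dec (f x ≡ n) → length (filter (λ x → f x ≟ n) (x ∷ xs)) ≡ occurrences (map f (x ∷ xs)) n
  by (yes fx≡n) = trans (cong length (filter-accept (λ x → f x ≟ n) {x} {xs} fx≡n))
    (cong₂ _+_ (sym (subst (λ m → monomial (f x) m ≡ 1) fx≡n (monomial-refl (f x)))) (length-filter-≟ f xs n))
  by (no  fx≢n) = trans (cong length (filter-reject (λ x → f x ≟ n) {x} {xs} fx≢n))
    (trans (length-filter-≟ f xs n) (cong (_+ occurrences (map f xs) n) (sym (monomial-≢ fx≢n))))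

hasCount-occurrences : ∀ {A : Set} {P : A → Set} (f : A → ℕ) xs → Unique xs →
  (∀ x → x ∈ xs → P x) → (∀ x → P x → x ∈ xs) → ∀ n → HasCount (λ x → P x × f x ≡ n) (occurrences (map f xs) n)
hasCount-occurrences f xs unique sound complete n =
    filter (λ x → f x ≟ n) xs
  , Unique.filter⁺ (λ x → f x ≟ n) unique
  , (λ x x∈ → let x∈xs , fx≡n = ∈-filter⁻ (λ x → f x ≟ n) x∈ in sound x x∈xs , fx≡n)
  , (λ x (px , fx≡n) → ∈-filter⁺ (λ x → f x ≟ n) (complete x px) fx≡n)
  , length-filter-≟ f xs n

Unique-map⁺-retraction : ∀ {A B : Set} {f : A → B} (g : B → A) {xs} → (∀ {x} → x ∈ xs → g (f x) ≡ x) →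
  Unique xs → Unique (map f xs)
Unique-map⁺-retraction         g {[]}     _       []              = []
Unique-map⁺-retraction {f = f} g {x ∷ xs} retract (x∉xs ∷ unique) =
  All.map⁺ (All.tabulate λ y∈ fx≡fy → All.lookup x∉xs y∈ (trans (sym (retract (here refl)))
                                                         (trans (cong g fx≡fy) (retract (there y∈)))))
  ∷ Unique-map⁺-retraction g (retract ∘ there) unique

-- Decoding Σ-tuples into diagrams and back

≤-chain : ∀ (f : ℕ → ℕ) {lo hi} → (∀ t → lo ≤ t → t < hi → f t ≤ f (suc t)) → ∀ {i} → lo ≤ i → i ≤ hi → f i ≤ f hi
≤-chain f {hi = zero}   step lo≤i z≤n = ≤-refl
≤-chain f {hi = suc hi} step {i} lo≤i i≤1+hi with i ≟ suc hi
... | yes refl = ≤-refl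
... | no  i≢   = ≤-trans (≤-chain f (λ t lo≤t t<hi → step t lo≤t (m<n⇒m<1+n t<hi)) lo≤i i≤hi)
                         (step hi (≤-trans lo≤i i≤hi) ≤-refl)
  where
  i≤hi : i ≤ hi
  i≤hi = ≤-pred (≤∧≢⇒< i≤1+hi i≢)

length*min≤sum : ∀ {X} xs → All (X ≤_) xs → length xs * X ≤ sum xs
length*min≤sum []       []            = z≤n
length*min≤sum (x ∷ xs) (X≤x ∷ X≤xs) = +-mono-≤ X≤x (length*min≤sum xs X≤xs)

Σ≤j*a : ∀ s j a p q y → q < p → j * p ≤ y → s + 2 * y ≤ j * (a + 1 + p + q) → s ≤ j * a
Σ≤j*a s j a p q y q<p jp≤y bound = +-cancelʳ-≤ (j * (p + q + 1)) s (j * a) (begin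
  s + j * (p + q + 1) ≤⟨ +-monoʳ-≤ s (≤-trans (*-monoʳ-≤ j p+q+1≤2p) (≤-reflexive (j*[p+p]≡2*[j*p])) ) ⟩
  s + 2 * (j * p)     ≤⟨ +-monoʳ-≤ s (*-monoʳ-≤ 2 jp≤y) ⟩
  s + 2 * y           ≤⟨ bound ⟩
  j * (a + 1 + p + q) ≡⟨ solve 4 (λ j a p q → j :* (a :+ con 1 :+ p :+ q) := j :* a :+ j :* (p :+ q :+ con 1))
                               refl j a p q ⟩
  j * a + j * (p + q + 1) ∎)
  where
  open ≤-Reasoning
  p+q+1≤2p : p + q + 1 ≤ p + p
  p+q+1≤2p = subst (_≤ p + p) (sym (+-assoc p q 1)) (+-monoʳ-≤ p (subst (_≤ p) (+-comm 1 q) q<p))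
  j*[p+p]≡2*[j*p] : j * (p + p) ≡ 2 * (j * p)
  j*[p+p]≡2*[j*p] = solve 2 (λ j p → j :* (p :+ p) := con 2 :* (j :* p)) refl j p

module Diagrams (a b : ℕ) {lam : List ℕ} (dec : Nonincreasing lam) (positive : All (1 ≤_) lam)
                (sum≡b : sum lam ≡ b) (1≤b : 1 ≤ b) where

  short : length lam ≤ b
  short = subst (length lam ≤_) sum≡b (length≤sum lam positive)

  open Tuples a b dec short public

  N : ℕ
  N = part lam 1

  1≤N : 1 ≤ N
  1≤N = head-positive lam positive sum≡b
    where
    head-positive : ∀ lam → All (1 ≤_) lam → sum lam ≡ b → 1 ≤ part lam 1
    head-positive []       _          refl = 1≤b
    head-positive (x ∷ xs) (1≤x ∷ _) _    = 1≤x

  open Rows 1≤N public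

  group : List ℕ → ℕ → List Key
  group σ l = map (_, l) (balanced (conj lam l) (σ ! l))

  keysOf : List ℕ → List Key
  keysOf σ = concatMap (group σ) (labels N)

  diagram : List ℕ → Diagram
  diagram σ = map row (sort (keysOf σ))

  sigmas : Diagram → List ℕ
  sigmas D = map (Sig D) (labels N)

  InGroup : List ℕ → Key → Set
  InGroup σ k = LabelInRange k × proj₁ k ∈ balanced (conj lam (proj₂ k)) (σ ! proj₂ k)

  group-labelled : ∀ σ l → All (λ k → proj₂ k ≡ l) (group σ l)
  group-labelled σ l = All.map⁺ (All.universal (λ _ → refl) _)

  map-proj₁-group : ∀ σ l → map proj₁ (group σ l) ≡ balanced (conj lam l) (σ ! l)
  map-proj₁-group σ l = trans (sym (map-∘ (balanced (conj lam l) (σ ! l)))) (map-id _)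

  ∈-keysOf⁻ : ∀ σ {k} → k ∈ keysOf σ → InGroup σ k
  ∈-keysOf⁻ σ k∈ with find (∈-concatMap⁻ (group σ) {xs = labels N} k∈)
  ... | l , l∈ , k∈group with ∈-map⁻ (_, l) k∈group
  ... | m , m∈ , refl = ∈-labels⁻ N l∈ , m∈

  filter-keysOf-∈ : ∀ σ {i} → 1 ≤ i → i ≤ N → filter (labelled? i) (keysOf σ) ≡ group σ i
  filter-keysOf-∈ σ 1≤i i≤N =
    filter-concatMap-∈ (group σ) (labels N) (labels-unique N) (group-labelled σ) (∈-labels⁺ N 1≤i i≤N)

  filter-keysOf-∉ : ∀ σ {i} → N < i → filter (labelled? i) (keysOf σ) ≡ []
  filter-keysOf-∉ σ N<i =
    filter-concatMap-∉ (group σ) (labels N) (group-labelled σ) (λ i∈ → <⇒≱ N<i (proj₂ (∈-labels⁻ N i∈)))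

  length-group : ∀ σ l → length (group σ l) ≡ conj lam l
  length-group σ l = trans (length-map (_, l) (balanced (conj lam l) (σ ! l))) (length-balanced (conj lam l) (σ ! l))

  length-keysOf : ∀ σ → length (keysOf σ) ≡ b
  length-keysOf σ = begin
    length (concatMap (group σ) (labels N))          ≡⟨ length-concatMap (labels N) ⟩
    sum (map (length ∘ group σ) (labels N))          ≡⟨ sum-map-cong (All.universal (length-group σ) (labels N)) ⟩
    sum (map (conj lam) (labels N))                  ≡⟨ sum-conj lam N (all≤N lam dec) ⟩
    sum lam                                          ≡⟨ sum≡b ⟩
    b                                                ∎
    where
    open ≡-Reasoning
    length-concatMap : ∀ (ls : List ℕ) → length (concatMap (group σ) ls) ≡ sum (map (length ∘ group σ) ls)
    length-concatMap []       = refl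
    length-concatMap (l ∷ ls) = trans (length-++ (group σ l)) (cong (length (group σ l) +_) (length-concatMap ls))
    all≤N : ∀ lam → Nonincreasing lam → All (_≤ part lam 1) lam
    all≤N []       _   = []
    all≤N (x ∷ xs) dec = all≤head dec

  sum-keysOf : ∀ σ → length σ ≡ N → sum (map proj₁ (keysOf σ)) ≡ sum σ
  sum-keysOf σ length-σ = begin
    sum (map proj₁ (concatMap (group σ) (labels N)))  ≡⟨ sum-concatMap (labels N) ⟩
    sum (map (sum ∘ map proj₁ ∘ group σ) (labels N))
      ≡⟨ sum-map-cong (All.tabulate (λ l∈ → sum-group (∈-labels⁻ N l∈))) ⟩
    sum (map (σ !_) (labels N))                      ≡⟨ cong (λ n → sum (map (σ !_) (labels n))) (sym length-σ) ⟩
    sum (map (σ !_) (labels (length σ)))             ≡⟨ cong sum (map-labels-!-length σ) ⟩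
    sum σ                                            ∎
    where
    open ≡-Reasoning
    sum-group : ∀ {l} → 1 ≤ l × l ≤ N → sum (map proj₁ (group σ l)) ≡ σ ! l
    sum-group {l} (1≤l , l≤N) =
      trans (cong sum (map-proj₁-group σ l)) (sum-balanced _ _ (proj₁ (inBlock-conj dec 1≤l l≤N)))
    sum-concatMap : ∀ (ls : List ℕ) →
      sum (map proj₁ (concatMap (group σ) ls)) ≡ sum (map (sum ∘ map proj₁ ∘ group σ) ls)
    sum-concatMap []       = refl
    sum-concatMap (l ∷ ls) =
      trans (sum-map-++ proj₁ (group σ l) _) (cong (sum (map proj₁ (group σ l)) +_) (sum-concatMap ls))

  sortedKeys : List ℕ → List Key
  sortedKeys σ = sort (keysOf σ)

  filter-sortedKeys-↭ : ∀ σ i → filter (labelled? i) (sortedKeys σ) ↭ filter (labelled? i) (keysOf σ)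
  filter-sortedKeys-↭ σ i = Perm.filter-↭ (labelled? i) (sort-↭ (keysOf σ))

  sortedKeys-facts : ∀ σ → All (InGroup σ) (sortedKeys σ)
  sortedKeys-facts σ = Perm.All-resp-↭ (↭-sym (sort-↭ (keysOf σ))) (All.tabulate (∈-keysOf⁻ σ))

  length-diagram : ∀ σ → length (diagram σ) ≡ b
  length-diagram σ = trans (length-map row (sortedKeys σ)) (trans (Perm.↭-length (sort-↭ (keysOf σ))) (length-keysOf σ))

  count-diagram : ∀ σ {i} → 1 ≤ i → length (rowsLabeled i (diagram σ)) ≡ conj lam i
  count-diagram σ {i} 1≤i = begin
    length (rowsLabeled i (diagram σ))                   ≡⟨ cong length (rowsLabeled-rows (sortedKeys σ) i) ⟩
    length (map row (filter (labelled? i) (sortedKeys σ))) ≡⟨ length-map row (filter (labelled? i) (sortedKeys σ)) ⟩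
    length (filter (labelled? i) (sortedKeys σ))         ≡⟨ Perm.↭-length (filter-sortedKeys-↭ σ i) ⟩
    length (filter (labelled? i) (keysOf σ))             ≡⟨ by-range (i ≤? N) ⟩
    conj lam i                                           ∎
    where
    open ≡-Reasoning
    by-range : Dec (i ≤ N) → length (filter (labelled? i) (keysOf σ)) ≡ conj lam i
    by-range (yes i≤N) = trans (cong length (filter-keysOf-∈ σ 1≤i i≤N)) (length-group σ i)
    by-range (no  i≰N) = trans (cong length (filter-keysOf-∉ σ (≰⇒> i≰N))) (sym (conj-head< dec (≰⇒> i≰N)))

  Sig-diagram : ∀ σ {i} → 1 ≤ i → i ≤ N → Sig (diagram σ) i ≡ σ ! i
  Sig-diagram σ {i} 1≤i i≤N = begin
    Sig (diagram σ) i                                    ≡⟨ Sig-rows (sortedKeys σ) i ⟩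
    sum (map proj₁ (filter (labelled? i) (sortedKeys σ))) ≡⟨ sum-↭ (Perm.map⁺ proj₁ (filter-sortedKeys-↭ σ i)) ⟩
    sum (map proj₁ (filter (labelled? i) (keysOf σ)))    ≡⟨ cong (sum ∘ map proj₁) (filter-keysOf-∈ σ 1≤i i≤N) ⟩
    sum (map proj₁ (group σ i))                          ≡⟨ cong sum (map-proj₁-group σ i) ⟩
    sum (balanced (conj lam i) (σ ! i))                  ≡⟨ sum-balanced _ _ (proj₁ (inBlock-conj dec 1≤i i≤N)) ⟩
    σ ! i                                                ∎
    where open ≡-Reasoning

  size-diagram : ∀ σ → length σ ≡ N → size (diagram σ) ≡ sum σ
  size-diagram σ length-σ =
    trans (size-rows (sortedKeys σ)) (trans (sum-↭ (Perm.map⁺ proj₁ (sort-↭ (keysOf σ)))) (sum-keysOf σ length-σ))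

  sigmas-diagram : ∀ σ → length σ ≡ N → sigmas (diagram σ) ≡ σ
  sigmas-diagram σ length-σ = begin
    map (Sig (diagram σ)) (labels N)
      ≡⟨ map-cong-local (All.tabulate (λ l∈ → let 1≤l , l≤N = ∈-labels⁻ N l∈ in Sig-diagram σ 1≤l l≤N)) ⟩
    map (σ !_) (labels N)                    ≡⟨ cong (λ n → map (σ !_) (labels n)) (sym length-σ) ⟩
    map (σ !_) (labels (length σ))           ≡⟨ map-labels-!-length σ ⟩
    σ                                        ∎
    where open ≡-Reasoning

  part≤N : ∀ {j} → 1 ≤ j → part lam j ≤ N
  part≤N 1≤j = part-antitone dec ≤-refl 1≤j

  module _ {σ : List ℕ} (admissible : AdmissibleFrom 1 σ) where

    condition : ∀ j → 1 ≤ j → ∀ i → part lam (suc j) < i → i ≤ part lam j → BlockCondition j σ i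
    condition = proj₂ admissible

    condition-label : ∀ {l} → 1 ≤ l → l ≤ N → BlockCondition (conj lam l) σ l
    condition-label 1≤l l≤N = let 1≤j , q<l , l≤p = inBlock-conj dec 1≤l l≤N in condition _ 1≤j _ q<l l≤p

    diagram-modular : IsModular N b (diagram σ)
    diagram-modular = subst (λ k → IsModular N k (diagram σ))
      (trans (Perm.↭-length (sort-↭ (keysOf σ))) (length-keysOf σ))
      (rows-modular (sortedKeys σ) (sort-↗ (keysOf σ)) (All.map proj₁ (sortedKeys-facts σ)))

    diagram-inRect : InRect a b (diagram σ)
    diagram-inRect = length-diagram σ , All.map⁺ (All.map row≤a (sortedKeys-facts σ))
      where
      Σ≤λ′*a : ∀ {l} → 1 ≤ l → l ≤ N → σ ! l ≤ conj lam l * a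
      Σ≤λ′*a {l} 1≤l l≤N = let _ , q<l , l≤p = inBlock-conj dec 1≤l l≤N ; j = conj lam l in
        Σ≤j*a (σ ! l) j a (part lam j) (part lam (suc j)) (Y lam j) (<-≤-trans q<l l≤p) (*-part≤Y dec j)
              (proj₂ (proj₁ (condition-label 1≤l l≤N)))
      row≤a : ∀ {k} → InGroup σ k → len (row k) ≤ a
      row≤a {m , l} ((1≤l , l≤N) , m∈) =
        subst (_≤ a) (sym (len-row (m , l))) (All.lookup (balanced-upper (conj lam l) (σ ! l) (Σ≤λ′*a 1≤l l≤N)) m∈)

    diagram-cond2 : Cond2 a lam (diagram σ)
    diagram-cond2 j 1≤j = chain , bound
      where
      chain : ∀ i → suc (part lam (suc j)) ≤ i → i < part lam j → Sig (diagram σ) i ≤ Sig (diagram σ) (suc i)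
      chain i q<i i<p = subst₂ _≤_ (sym (Sig-diagram σ (≤-trans (s≤s z≤n) q<i) (≤-trans (<⇒≤ i<p) (part≤N 1≤j))))
                                   (sym (Sig-diagram σ (s≤s z≤n) (≤-trans i<p (part≤N 1≤j))))
                                   (proj₂ (condition j 1≤j i q<i (<⇒≤ i<p)) i<p)
      bound : part lam (suc j) < part lam j →
        Sig (diagram σ) (part lam j) + 2 * Y lam j ≤ j * (a + 1 + part lam j + part lam (suc j))
      bound q<p = subst (λ s → s + 2 * Y lam j ≤ _) (sym (Sig-diagram σ (≤-trans (s≤s z≤n) q<p) (part≤N 1≤j)))
                        (proj₂ (proj₁ (condition j 1≤j _ q<p ≤-refl)))

    diagram-cond3 : Cond3 lam (diagram σ)
    diagram-cond3 j 1≤j = All.map⁺ (All.map long (sortedKeys-facts σ))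
      where
      long : ∀ {k} → InGroup σ k →
        suc (part lam (suc j)) ≤ label (row k) → label (row k) ≤ part lam j →
        part lam j + part lam (suc j) ∸ 1 ≤ len (row k)
      long {m , l} ((1≤l , l≤N) , m∈) q<l l≤p rewrite label-row (m , l) | len-row (m , l) =
        All.lookup (balanced-lower (conj lam l) (σ ! l) (subst (λ c → c * (part lam j + part lam (suc j) ∸ 1) ≤ σ ! l)
                                              (sym (conj≡ dec 1≤l 1≤j q<l l≤p))
                                              (proj₁ (proj₁ (condition j 1≤j l q<l l≤p))))) m∈

    diagram-cond4 : Cond4 (diagram σ)
    diagram-cond4 i rewrite rowsLabeled-rows (sortedKeys σ) i =
      All.map⁺ (All.tabulate λ k∈ → All.map⁺ (All.tabulate λ k′∈ → close k∈ k′∈))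
      where
      lengths∈ : ∀ {k} → k ∈ filter (labelled? i) (sortedKeys σ) → proj₁ k ∈ balanced (conj lam i) (σ ! i)
      lengths∈ k∈ = let k∈K , l≡i = ∈-filter⁻ (labelled? i) k∈ in
        subst (λ l → _ ∈ balanced (conj lam l) (σ ! l)) l≡i (proj₂ (All.lookup (sortedKeys-facts σ) k∈K))
      close : ∀ {k k′} → k ∈ filter (labelled? i) (sortedKeys σ) → k′ ∈ filter (labelled? i) (sortedKeys σ) →
        len (row k) ≤ suc (len (row k′))
      close {k} {k′} k∈ k′∈ rewrite len-row k | len-row k′ =
        balanced-close (conj lam i) (σ ! i) (lengths∈ k∈) (lengths∈ k′∈)

    diagram-valid : Valid a b lam (diagram σ)
    diagram-valid = diagram-modular , diagram-inRect , (λ i 1≤i → count-diagram σ 1≤i)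
                  , diagram-cond2 , diagram-cond3 , diagram-cond4

  module _ {D : Diagram} (valid : Valid a b lam D) where

    private
      modular : IsModular N b D
      modular = proj₁ valid
      count : Cond1 lam D
      count = proj₁ (proj₂ (proj₂ valid))
      cond2 : Cond2 a lam D
      cond2 = proj₁ (proj₂ (proj₂ (proj₂ valid)))
      cond3 : Cond3 lam D
      cond3 = proj₁ (proj₂ (proj₂ (proj₂ (proj₂ valid))))
      cond4 : Cond4 D
      cond4 = proj₂ (proj₂ (proj₂ (proj₂ (proj₂ valid))))
      nonEmpty : All (λ r → 1 ≤ length r) D
      nonEmpty = proj₁ (proj₂ modular)
      shorter : ∀ i → len (rowAt D (suc i)) ≤ len (rowAt D i)
      shorter = proj₁ (proj₂ (proj₂ modular))
      cells : All (All (λ x → 1 ≤ x × x ≤ N)) D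
      cells = proj₁ (proj₂ (proj₂ (proj₂ modular)))
      nonLast : ∀ i c → suc c < length (rowAt D i) → cell D i c ≡ N
      nonLast = proj₁ (proj₂ (proj₂ (proj₂ (proj₂ modular))))
      column : ∀ i j c → i < j → c < length (rowAt D j) → cell D j c ≤ cell D i c
      column = proj₂ (proj₂ (proj₂ (proj₂ (proj₂ modular))))

    sigmas-! : ∀ {l} → 1 ≤ l → l ≤ N → sigmas D ! l ≡ Sig D l
    sigmas-! = !-map-labels (Sig D) N

    rows-of-keys : map row (map key D) ≡ D
    rows-of-keys = trans (sym (map-∘ D)) (trans (map-cong-local shapes) (map-id D))
      where
      shapes : All (λ r → row (key r) ≡ r) D
      shapes = All.zipWith (λ (1≤∣r∣ , nonLast-r) → row-key _ 1≤∣r∣ nonLast-r) (nonEmpty , All-nonLastCells⁺ D nonLast)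

    labels-in-range : All (λ k → proj₂ k ∈ labels N) (map key D)
    labels-in-range = All.map⁺ (All.zipWith label∈labels (nonEmpty , cells))
      where
      label∈labels : ∀ {r} → 1 ≤ length r × All (λ x → 1 ≤ x × x ≤ N) r → label r ∈ labels N
      label∈labels {r} (1≤∣r∣ , r-cells) = let 1≤l , l≤N = All.lookup r-cells (label∈ r 1≤∣r∣) in ∈-labels⁺ N 1≤l l≤N

    group-↭ : ∀ {l} → l ∈ labels N → filter (labelled? l) (map key D) ↭ group (sigmas D) l
    group-↭ {l} l∈ rewrite filter-labelled-keys D l =
      Perm.map⁺ (_, l) (subst₂ (λ c s → lengths ↭ balanced c s)
                                (trans (length-map len (rowsLabeled l D)) (count l 1≤l))
                                (sym (sigmas-! 1≤l l≤N))
                                (balanced-↭ lengths close))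
      where
      1≤l : 1 ≤ l
      1≤l = proj₁ (∈-labels⁻ N l∈)
      l≤N : l ≤ N
      l≤N = proj₂ (∈-labels⁻ N l∈)
      lengths : List ℕ
      lengths = map len (rowsLabeled l D)
      close : ∀ {x y} → x ∈ lengths → y ∈ lengths → x ≤ suc y
      close x∈ y∈ with ∈-map⁻ len x∈ | ∈-map⁻ len y∈
      ... | r , r∈ , refl | s , s∈ , refl = All.lookup (All.lookup (cond4 l) r∈) s∈

    keys-↭ : map key D ↭ keysOf (sigmas D)
    keys-↭ = ↭-trans (↭-concatMap-filter-labelled (labels N) (map key D) (labels-unique N) labels-in-range)
                     (concatMap-↭ (labels N) (All.tabulate group-↭))

    diagram-sigmas : diagram (sigmas D) ≡ D
    diagram-sigmas = trans (cong (map row) (sym keys≡)) rows-of-keys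
      where
      keys≡ : map key D ≡ sortedKeys (sigmas D)
      keys≡ = sorted-↭⇒≡ (keys-sorted D nonEmpty shorter column) (sort-↗ (keysOf (sigmas D)))
                         (↭-trans keys-↭ (↭-sym (sort-↭ (keysOf (sigmas D)))))

    sigmas-admissible : AdmissibleFrom 1 (sigmas D)
    sigmas-admissible = length-map-labels (Sig D) N , conditions
      where
      conditions : ∀ j → 1 ≤ j → ∀ i → part lam (suc j) < i → i ≤ part lam j → BlockCondition j (sigmas D) i
      conditions j 1≤j i q<i i≤p rewrite sigmas-! (≤-trans (s≤s z≤n) q<i) (≤-trans i≤p (part≤N 1≤j)) =
        (lower , upper) , step
        where
        1≤i : 1 ≤ i
        1≤i = ≤-trans (s≤s z≤n) q<i
        lengths : List ℕ
        lengths = map len (rowsLabeled i D)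
        long : All (part lam j + part lam (suc j) ∸ 1 ≤_) lengths
        long = All.map⁺ (All.tabulate λ {r} r∈ → let r∈D , label≡i = ∈-filter⁻ (λ r → label r ≟ i) r∈ in
          subst (λ l → suc (part lam (suc j)) ≤ l → l ≤ part lam j → _ ≤ len r) label≡i
                (All.lookup (cond3 j 1≤j) r∈D) q<i i≤p)
        lower : ΣMin j ≤ Sig D i
        lower = subst (λ c → c * (part lam j + part lam (suc j) ∸ 1) ≤ Sig D i)
                      (trans (length-map len (rowsLabeled i D)) (trans (count i 1≤i) (conj≡ dec 1≤i 1≤j q<i i≤p)))
                      (length*min≤sum lengths long)
        upper : Sig D i + twiceY j ≤ ΣMax j
        upper = ≤-trans (+-monoˡ-≤ (twiceY j) (≤-chain (Sig D) (proj₁ (cond2 j 1≤j)) q<i i≤p))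
                        (proj₂ (cond2 j 1≤j) (<-≤-trans q<i i≤p))
        step : suc i ≤ part lam j → Sig D i ≤ sigmas D ! suc i
        step i<p rewrite sigmas-! (s≤s z≤n) (≤-trans i<p (part≤N 1≤j)) = proj₁ (cond2 j 1≤j) i q<i i<p

  diagrams : List Diagram
  diagrams = map diagram (tuples 1 b)

  admissible-tuples : ∀ {σ} → σ ∈ tuples 1 b → AdmissibleFrom 1 σ
  admissible-tuples {σ} = tuples-sound b 1 (s≤s z≤n) refl {σ}

  diagrams-unique : Unique diagrams
  diagrams-unique = Unique-map⁺-retraction sigmas (λ {σ} σ∈ → sigmas-diagram σ (proj₁ (admissible-tuples σ∈)))
                                           (tuples-unique b 1 (s≤s z≤n) refl)

  ∈-diagrams⁻ : ∀ D → D ∈ diagrams → Valid a b lam D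
  ∈-diagrams⁻ D D∈ with ∈-map⁻ diagram D∈
  ... | σ , σ∈ , refl = diagram-valid {σ} (admissible-tuples σ∈)

  ∈-diagrams⁺ : ∀ D → Valid a b lam D → D ∈ diagrams
  ∈-diagrams⁺ D valid = subst (_∈ diagrams) (diagram-sigmas valid)
    (∈-map⁺ diagram (tuples-complete b 1 (s≤s z≤n) refl {sigmas D} (sigmas-admissible valid)))

  occurrences-size-diagrams : ∀ n → occurrences (map size diagrams) n ≡ coeff (F a b lam) n
  occurrences-size-diagrams n = trans (cong (λ xs → occurrences xs n) sizes) (sym (coeff-F n))
    where
    sizes : map size diagrams ≡ map sum (tuples 1 b)
    sizes = trans (sym (map-∘ (tuples 1 b)))
                  (map-cong-local (All.tabulate (λ {σ} σ∈ → size-diagram σ (proj₁ (admissible-tuples σ∈)))))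

theorem3p2 : (a b : ℕ) → 1 ≤ a → 1 ≤ b → (lam : List ℕ) → IsPartitionOf b lam →
    (n : ℕ) → HasCount (λ D → Valid a b lam D × size D ≡ n) (coeff (F a b lam) n)
theorem3p2 a b _ 1≤b lam (dec , positive , sum≡b) n =
  subst (HasCount _) (occurrences-size-diagrams n)
    (hasCount-occurrences size diagrams diagrams-unique ∈-diagrams⁻ ∈-diagrams⁺ n)
  where open Diagrams a b dec positive sum≡b 1≤b
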